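{- Let $(\Psi,\vec u,E)$ be a gcd-to-div triple, with witnessing variable families $\vec z,\vec y,\vec w$. If $\Psi$ is not in increasing form (for any order), then there is a non-constant polynomial $f$ that is the primitive part of a left-hand side of $\Psi$ such that $M_f(\Psi)\cap\mathbb{Z}\ne\{0\}$. If $\Psi$ is in increasing form (for some order), then it is in increasing form for every order in $(\vec z\prec\vec y\prec\vec w)$.
   Context: Linear polynomials have integer coefficients and constant; primitive means non-zero with gcd of coefficients and constant equal to $1$; the primitive part of non-zero $g$ is the primitive $f$ with $g=\gcd(g)f$. $\mathbb{Z}$ inside $M_f(\Psi)\cap\mathbb{Z}$ denotes the constant polynomials. Divisibility $m\mid n$ of integers holds iff $n=qm$ for a unique $q$. A system of divisibility constraints is $\bigwedge f_i\mid g_i$ with linear $f_i\ne0$, $g_i$. For a total order $x_1\prec\dots\prec x_n$, $\mathrm{lv}(f)$ is the $\prec$-largest variable with non-zero coefficient. The divisibility module $M_f(\Psi)$ of primitive $f$ is the smallest set of linear polynomials containing $f$, closed under integer linear combinations, such that if $g\mid h$ is in $\Psi$ and $bg\in M_f(\Psi)$ then $bh\in M_f(\Psi)$. $\Psi$ is in increasing form w.r.t. $\prec$ if $M_f(\Psi)\cap\mathbb{Z}[x_1,\dots,x_k]=\{bf:b\in\mathbb{Z}\}$ for every $k$ and every primitive $f$ with $\mathrm{lv}(f)=x_k$ ($\mathbb{Z}[x_1,\dots,x_k]$: linear polynomials in $x_1,\dots,x_k$). $(\vec z\prec\vec y\prec\vec w)$ denotes the set of total orders in which every variable of $\vec z$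 precedes every variable of $\vec y$, which precedes every variable of $\vec w$. A triple $(\Psi,\vec u,E)$ is a gcd-to-div triple if there are $d,m\in\mathbb{N}$ and disjoint families $\vec z,\vec y,\vec w$ such that: (1) $\Psi(\vec z,\vec y,\vec w)$ is a divisibility system in $m$ variables, $\vec u\in\mathbb{Z}^d$, $E\in\mathbb{Z}^{d\times m}$ with columns corresponding to variables of $\Psi$; (2) each divisibility has the form $h(\vec z)\mid f(\vec y)$ or $f(\vec y)\mid g(\vec w)$ with $g$ non-constant, all coefficients and constants non-negative, every left-hand side with strictly positive constant; (3) each variable $z$ of $\vec z$ appears in a single polynomial $z+c$ ($c$ positive integer) occurring in precisely two divisibilities as left-hand side; (4) each variable $w$ of $\vec w$ appears in exactly two polynomials $w$ and $w+c$ ($c$ positive integer), each occurring exactly once as right-hand side; (5) columns of $E$ for variables in $\vec z$ or $\vec w$ are zero. -}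

module Defs where

open import Data.Nat using (ℕ; zero; suc)
open import Data.Integer as ℤ using (ℤ; +_; 0ℤ; 1ℤ; _<_; _≤_)
open import Data.Integer.GCD using (gcd)
open import Data.Fin as Fin using (Fin)
open import Data.Vec as Vec using (Vec; lookup; tabulate; zipWith; toList)
import Data.List as List
open import Data.List using (List; foldr)
open import Data.List.Membership.Propositional using (_∈_)
open import Data.Product using (Σ; ∃; ∃-syntax; _×_; _,_)
open import Data.Sum using (_⊎_)
open import Relation.Nullary using (¬_; does)
open import Relation.Binary.PropositionalEquality using (_≡_; _≢_)
open import Data.Bool using (if_then_else_)
open import Function.Definitions using (Injective)

record Lin (m : ℕ) : Set where
  constructor lin
  field
    coeffs : Vec ℤ m
    const  : ℤ
open Lin public

coeff : ∀ {m} → Lin m → Fin m → ℤ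
coeff p j = lookup (coeffs p) j

_+P_ : ∀ {m} → Lin m → Lin m → Lin m
p +P q = lin (zipWith ℤ._+_ (coeffs p) (coeffs q)) (const p ℤ.+ const q)

_·P_ : ∀ {m} → ℤ → Lin m → Lin m
a ·P p = lin (Vec.map (a ℤ.*_) (coeffs p)) (a ℤ.* const p)

constP : ∀ {m} → ℤ → Lin m
constP {m} c = lin (Vec.replicate m 0ℤ) c

varP : ∀ {m} → Fin m → ℤ → Lin m
varP v c = lin (tabulate (λ j → if does (j Fin.≟ v) then 1ℤ else 0ℤ)) c

NonZeroP : ∀ {m} → Lin m → Set
NonZeroP {m} p = p ≢ constP 0ℤ

NonConst : ∀ {m} → Lin m → Set
NonConst p = ∃[ j ] coeff p j ≢ 0ℤ

gcdP : ∀ {m} → Lin m → ℤ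
gcdP p = foldr gcd 0ℤ (const p List.∷ toList (coeffs p))

Primitive : ∀ {m} → Lin m → Set
Primitive p = NonZeroP p × gcdP p ≡ 1ℤ

PrimitivePartOf : ∀ {m} → Lin m → Lin m → Set
PrimitivePartOf f g = NonZeroP g × Primitive f × g ≡ gcdP g ·P f

record Div (m : ℕ) : Set where
  constructor _∣'_
  field
    lhs : Lin m
    rhs : Lin m
open Div public

System : ℕ → Set
System m = List (Div m)

IsDivSystem : ∀ {m} → System m → Set
IsDivSystem Ψ = ∀ {D} → D ∈ Ψ → NonZeroP (lhs D)

data M {m : ℕ} (Ψ : System m) (f : Lin m) : Lin m → Set where
  base  : M Ψ f f
  combo : ∀ a b {g h} → M Ψ f g → M Ψ f h → M Ψ f ((a ·P g) +P (b ·P h))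
  divs  : ∀ {g h} (b : ℤ) → (g ∣' h) ∈ Ψ → M Ψ f (b ·P g) → M Ψ f (b ·P h)

-- Total orders on the variables: an injective rank function
-- (x_i ≺ x_j iff rank i < rank j).

record Order (m : ℕ) : Set where
  field
    rank     : Fin m → Fin m
    rank-inj : Injective _≡_ _≡_ rank
open Order public

-- g ∈ ℤ[x_1,…,x_k] where x_k = lv(f): every variable occurring in g
-- is ≼ some variable occurring in f (i.e. ≼ the ≺-largest one).
BelowLv : ∀ {m} → Order m → Lin m → Lin m → Set
BelowLv ord f g =
  ∀ j → coeff g j ≢ 0ℤ → ∃[ i ] (coeff f i ≢ 0ℤ × Order.rank ord j Fin.≤ Order.rank ord i)

-- Ψ is in increasing form w.r.t. ord: for every primitive f with a leading
-- variable x_k, M_f(Ψ) ∩ ℤ[x_1,…,x_k] = { b f : b ∈ ℤ }.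
-- (The inclusion ⊇ holds by closure, so only ⊆ is stated.)
IncreasingForm : ∀ {m} → System m → Order m → Set
IncreasingForm {m} Ψ ord =
  ∀ (f : Lin m) → Primitive f → NonConst f →
  ∀ (g : Lin m) → M Ψ f g → BelowLv ord f g → ∃[ b ] g ≡ b ·P f

data VarClass : Set where
  Zv Yv Wv : VarClass

classRank : VarClass → ℕ
classRank Zv = 0
classRank Yv = 1
classRank Wv = 2

RespectsClasses : ∀ {m} → (Fin m → VarClass) → Order m → Set
RespectsClasses cls ord =
  ∀ i j → classRank (cls i) Data.Nat.< classRank (cls j) →
  Order.rank ord i Fin.< Order.rank ord j

OnlyIn : ∀ {m} → (Fin m → VarClass) → VarClass → Lin m → Set
OnlyIn cls c p = ∀ j → coeff p j ≢ 0ℤ → cls j ≡ c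

NonNeg : ∀ {m} → Lin m → Set
NonNeg p = (∀ j → 0ℤ ≤ coeff p j) × 0ℤ ≤ const p

-- counting occurrences by positions in the list
ExactlyOne : ∀ {n} → (Fin n → Set) → Set
ExactlyOne P = ∃[ i ] (P i × ∀ k → P k → k ≡ i)

ExactlyTwo : ∀ {n} → (Fin n → Set) → Set
ExactlyTwo P = ∃[ i ] ∃[ j ] (i ≢ j × P i × P j × ∀ k → P k → k ≡ i ⊎ k ≡ j)

AsLHS : ∀ {m} (Ψ : System m) → Lin m → Fin (List.length Ψ) → Set
AsLHS Ψ p i = lhs (List.lookup Ψ i) ≡ p

AsRHS : ∀ {m} (Ψ : System m) → Lin m → Fin (List.length Ψ) → Set
AsRHS Ψ p i = rhs (List.lookup Ψ i) ≡ p

Occurs : ∀ {m} → System m → Lin m → Set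
Occurs Ψ p = ∃[ D ] (D ∈ Ψ × (lhs D ≡ p ⊎ rhs D ≡ p))

WellShaped : ∀ {m} → (Fin m → VarClass) → Div m → Set
WellShaped cls D =
  ((OnlyIn cls Zv (lhs D) × OnlyIn cls Yv (rhs D))
   ⊎ (OnlyIn cls Yv (lhs D) × OnlyIn cls Wv (rhs D) × NonConst (rhs D)))
  × NonNeg (lhs D) × NonNeg (rhs D) × 0ℤ < const (lhs D)

record GcdToDiv {d m : ℕ} (Ψ : System m) (u : Vec ℤ d) (E : Vec (Vec ℤ m) d)
                (cls : Fin m → VarClass) : Set where
  field
    divSystem : IsDivSystem Ψ
    shape     : ∀ {D} → D ∈ Ψ → WellShaped cls D
    zVars     : ∀ v → cls v ≡ Zv →
      ∃[ c ] (0ℤ < c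
             × (∀ p → Occurs Ψ p → coeff p v ≢ 0ℤ → p ≡ varP v c)
             × ExactlyTwo (AsLHS Ψ (varP v c)))
    wVars     : ∀ v → cls v ≡ Wv →
      ∃[ c ] (0ℤ < c
             × (∀ p → Occurs Ψ p → coeff p v ≢ 0ℤ → p ≡ varP v 0ℤ ⊎ p ≡ varP v c)
             × ExactlyOne (AsRHS Ψ (varP v 0ℤ))
             × ExactlyOne (AsRHS Ψ (varP v c)))
    zeroCols  : ∀ j → (cls j ≡ Zv ⊎ cls j ≡ Wv) → ∀ r → lookup (lookup E r) j ≡ 0ℤ

{-# OPTIONS --safe #-}

-- A polynomial f is either linearly independent of every left-hand side, and then
-- M_f(Ψ) = ℤ f, or proportional to a left-hand side, which is z + c or a y-polynomial.
-- In the latter cases M_f(Ψ) is explicit: modulo w-polynomials vanishing at a suitable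
-- point it is spanned by f and two y-polynomials q₁, q₂ (the two right-hand sides of
-- z + c, resp. f and 0), unless 1 is a rational combination of q₁, q₂ or the
-- right-hand sides w and w + c both follow from spanned left-hand sides; each of these
-- two obstructions puts a non-zero constant into M_f(Ψ). So M_f(Ψ) ∩ ℤ ≠ {0} is
-- decidable, and otherwise every element of M_f(Ψ) below lv(f) for an order in
-- (z ≺ y ≺ w) is a multiple of f. Increasing form for some order rules out such
-- constants, giving increasing form for all orders in (z ≺ y ≺ w); if no order works,
-- a primitive part of a left-hand side must have a constant in its module.

module Submission where

open import Defs
open import Data.Nat as ℕ using (ℕ; zero; suc)
import Data.Nat.Properties as ℕP
open import Data.Nat.DivMod using (_/_; m/n*n≡m)
open import Data.Nat.Divisibility using (_∣_; ∣-trans)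
import Data.Nat.GCD as ℕGCD
open import Data.Integer as ℤ using (ℤ; +_; -_; 0ℤ; 1ℤ; _+_; _*_; _-_)
import Data.Integer.Properties as ℤP
open import Data.Integer.GCD using (gcd)
open import Data.Integer.Tactic.RingSolver using (solve-∀)
open import Algebra.Properties.AbelianGroup ℤP.+-0-abelianGroup using () renaming (∙-cancelˡ to +-cancelˡ)
open import Data.Fin as Fin using (Fin)
import Data.Fin.Properties as FinP
open import Data.Fin.Subset using (Subset; _⊂_; ∣_∣) renaming (_∈_ to _∈ₛ_)
import Data.Fin.Subset.Properties as SubsetP
open import Data.Vec as Vec using (Vec; []; _∷_; lookup; tabulate)
import Data.Vec.Properties as VecP
open import Data.List as List using (List)
open import Data.List.Relation.Unary.Any as Any using (here; there)
import Data.List.Relation.Unary.Any.Properties as AnyP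
open import Data.List.Membership.Propositional using (_∈_)
open import Data.List.Membership.Propositional.Properties using (∈-lookup)
open import Data.Product using (Σ; ∃-syntax; _×_; _,_; proj₁; proj₂)
open import Data.Sum using (_⊎_; inj₁; inj₂)
open import Data.Empty using (⊥-elim)
open import Data.Bool using (true; if_then_else_)
open import Function using (_∘_)
open import Function.Definitions using (Injective)
open import Relation.Nullary using (¬_; Dec; yes; no; does; proof; ¬?; _×-dec_; _⊎-dec_)
open import Relation.Nullary.Decidable as Dec using (dec-true)
open import Relation.Nullary.Reflects using (Reflects; invert)
open import Relation.Binary.Definitions using (tri<; tri≈; tri>)
open import Relation.Binary.PropositionalEquality

private
  variable
    m n : ℕ

∃∈? : ∀ {A : Set} (xs : List A) {P : (x : A) → x ∈ xs → Set} →
      (∀ x (x∈xs : x ∈ xs) → Dec (P x x∈xs)) → Dec (∃[ x ] Σ (x ∈ xs) (P x))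
∃∈? List.[] P? = no λ ()
∃∈? (x List.∷ xs) P? with P? x (here refl) | ∃∈? xs (λ y y∈xs → P? y (there y∈xs))
... | yes px | _ = yes (x , here refl , px)
... | no _ | yes (y , y∈xs , py) = yes (y , there y∈xs , py)
... | no ¬px | no ¬rest = no λ where
  (_ , here refl , px) → ¬px px
  (y , there y∈xs , py) → ¬rest (y , y∈xs , py)

*-≢0 : ∀ {a b} → a ≢ 0ℤ → b ≢ 0ℤ → a * b ≢ 0ℤ
*-≢0 {a} a≢0 b≢0 ab≡0 with ℤP.i*j≡0⇒i≡0∨j≡0 a ab≡0
... | inj₁ a≡0 = a≢0 a≡0
... | inj₂ b≡0 = b≢0 b≡0

*≡0⇒≡0 : ∀ a {b} → b ≢ 0ℤ → a * b ≡ 0ℤ → a ≡ 0ℤ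
*≡0⇒≡0 a b≢0 ab≡0 with ℤP.i*j≡0⇒i≡0∨j≡0 a ab≡0
... | inj₁ a≡0 = a≡0
... | inj₂ b≡0 = ⊥-elim (b≢0 b≡0)

*-cancelˡ-≢0 : ∀ b {x y} → b ≢ 0ℤ → b * x ≡ b * y → x ≡ y
*-cancelˡ-≢0 b {x} {y} b≢0 = ℤP.*-cancelˡ-≡ b x y {{ℤ.≢-nonZero b≢0}}

¬≢0⇒≡0 : ∀ {x} → ¬ (x ≢ 0ℤ) → x ≡ 0ℤ
¬≢0⇒≡0 {x} h with x ℤ.≟ 0ℤ
... | yes x≡0 = x≡0
... | no x≢0 = ⊥-elim (h x≢0)

entry : Lin m → Fin (suc m) → ℤ
entry p Fin.zero = const p
entry p (Fin.suc j) = coeff p j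

Vec-ext : {xs ys : Vec ℤ n} → (∀ i → lookup xs i ≡ lookup ys i) → xs ≡ ys
Vec-ext {xs = xs} {ys} h =
  trans (sym (VecP.tabulate∘lookup xs)) (trans (VecP.tabulate-cong h) (VecP.tabulate∘lookup ys))

Lin-ext : {p q : Lin m} → (∀ k → entry p k ≡ entry q k) → p ≡ q
Lin-ext {p = lin _ _} {lin _ _} h = cong₂ lin (Vec-ext (h ∘ Fin.suc)) (h Fin.zero)

entry-+P : ∀ (p q : Lin m) k → entry (p +P q) k ≡ entry p k + entry q k
entry-+P p q Fin.zero = refl
entry-+P p q (Fin.suc j) = VecP.lookup-zipWith _+_ j (coeffs p) (coeffs q)

entry-·P : ∀ a (p : Lin m) k → entry (a ·P p) k ≡ a * entry p k
entry-·P a p Fin.zero = refl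
entry-·P a p (Fin.suc j) = VecP.lookup-map j (a *_) (coeffs p)

entry-lincomb : ∀ a b (p q : Lin m) k →
                entry ((a ·P p) +P (b ·P q)) k ≡ a * entry p k + b * entry q k
entry-lincomb a b p q k = trans (entry-+P (a ·P p) (b ·P q) k) (cong₂ _+_ (entry-·P a p k) (entry-·P b q k))

coeff-constP : ∀ c (j : Fin m) → coeff (constP c) j ≡ 0ℤ
coeff-constP c j = VecP.lookup-replicate j 0ℤ

entry-constP-0 : ∀ k → entry (constP {m} 0ℤ) k ≡ 0ℤ
entry-constP-0 Fin.zero = refl
entry-constP-0 (Fin.suc j) = coeff-constP 0ℤ j

·P-constP : ∀ a c → a ·P constP {m} c ≡ constP (a * c)
·P-constP a c = Lin-ext λ where
  Fin.zero → refl
  (Fin.suc j) → trans (entry-·P a (constP c) (Fin.suc j))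
                      (trans (cong (a *_) (coeff-constP c j)) (trans (ℤP.*-zeroʳ a) (sym (coeff-constP (a * c) j))))

·P-identity : ∀ (p : Lin m) → 1ℤ ·P p ≡ p
·P-identity p = Lin-ext λ k → trans (entry-·P 1ℤ p k) (ℤP.*-identityˡ (entry p k))

·P-assoc : ∀ a b (p : Lin m) → a ·P (b ·P p) ≡ (a * b) ·P p
·P-assoc a b p = Lin-ext λ i → trans (entry-·P a (b ·P p) i)
  (trans (cong (a *_) (entry-·P b p i)) (trans (sym (ℤP.*-assoc a b (entry p i))) (sym (entry-·P (a * b) p i))))

coeff-varP : ∀ (v : Fin m) c j → coeff (varP v c) j ≡ (if does (j Fin.≟ v) then 1ℤ else 0ℤ)
coeff-varP v c j = VecP.lookup∘tabulate _ j

coeff-varP-self : ∀ (v : Fin m) c → coeff (varP v c) v ≡ 1ℤ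
coeff-varP-self v c with v Fin.≟ v | coeff-varP v c v
... | yes _ | eq = eq
... | no v≢v | _ = ⊥-elim (v≢v refl)

coeff-varP-≢0 : ∀ (v : Fin m) c j → coeff (varP v c) j ≢ 0ℤ → j ≡ v
coeff-varP-≢0 v c j h with j Fin.≟ v | coeff-varP v c j
... | yes j≡v | _ = j≡v
... | no _ | eq = ⊥-elim (h eq)

_≟P_ : (p q : Lin m) → Dec (p ≡ q)
p ≟P q with FinP.all? (λ k → entry p k ℤ.≟ entry q k)
... | yes eq = yes (Lin-ext eq)
... | no ¬eq = no λ { refl → ¬eq (λ _ → refl) }

-- Rational span of two integer vectors

module _ {n : ℕ} where

  _∥_ : (u v : Fin n → ℤ) → Set
  u ∥ v = ∀ i j → u i * v j ≡ u j * v i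

  InSpan : (x q₁ q₂ : Fin n → ℤ) → Set
  InSpan x q₁ q₂ = ∃[ b ] ∃[ a₁ ] ∃[ a₂ ] (b ≢ 0ℤ × ∀ k → b * x k ≡ a₁ * q₁ k + a₂ * q₂ k)

  ∥-sym : ∀ {u v} → u ∥ v → v ∥ u
  ∥-sym {u} {v} u∥v i j =
    trans (ℤP.*-comm (v i) (u j)) (trans (u∥v j i) (ℤP.*-comm (u i) (v j)))

  ∥-dec : ∀ u v → Dec (u ∥ v)
  ∥-dec u v = FinP.all? λ i → FinP.all? λ j → u i * v j ℤ.≟ u j * v i

  multiple⇒∥ : ∀ {u v b a} → b ≢ 0ℤ → (∀ k → b * u k ≡ a * v k) → u ∥ v
  multiple⇒∥ {u} {v} {b} {a} b≢0 bu≡av i j = *-cancelˡ-≢0 b b≢0 (begin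
    b * (u i * v j)   ≡⟨ sym (ℤP.*-assoc b (u i) (v j)) ⟩
    b * u i * v j     ≡⟨ cong (_* v j) (bu≡av i) ⟩
    a * v i * v j     ≡⟨ swap a (v i) (v j) ⟩
    a * v j * v i     ≡⟨ cong (_* v i) (sym (bu≡av j)) ⟩
    b * u j * v i     ≡⟨ ℤP.*-assoc b (u j) (v i) ⟩
    b * (u j * v i)   ∎)
    where
      open ≡-Reasoning
      swap : ∀ a x y → a * x * y ≡ a * y * x
      swap = solve-∀

  ∥-support : ∀ {u v i j} → u ∥ v → u i ≢ 0ℤ → v j ≢ 0ℤ → v i ≢ 0ℤ
  ∥-support {u} {v} {i} {j} u∥v ui≢0 vj≢0 vi≡0 =
    *-≢0 ui≢0 vj≢0 (trans (u∥v i j) (trans (cong (u j *_) vi≡0) (ℤP.*-zeroʳ (u j))))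

  InSpan-swap : ∀ {x q₁ q₂} → InSpan x q₁ q₂ → InSpan x q₂ q₁
  InSpan-swap {q₁ = q₁} {q₂} (b , a₁ , a₂ , b≢0 , eq) = b , a₂ , a₁ , b≢0 , λ k →
    trans (eq k) (ℤP.+-comm (a₁ * q₁ k) (a₂ * q₂ k))

  module _ {x q₁ q₂ : Fin n → ℤ} (q₁∥q₂ : q₁ ∥ q₂) {k} (q₁k≢0 : q₁ k ≢ 0ℤ) where

    ∥⇒InSpan : x ∥ q₁ → InSpan x q₁ q₂
    ∥⇒InSpan x∥q₁ = q₁ k , x k , 0ℤ , q₁k≢0 , λ l →
      trans (ℤP.*-comm (q₁ k) (x l)) (trans (sym (x∥q₁ k l)) (sym (ℤP.+-identityʳ _)))

    -- multiplying by q₁ k turns a₂ q₂ into a multiple of q₁, as q₁ ∥ q₂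
    InSpan⇒∥ : InSpan x q₁ q₂ → x ∥ q₁
    InSpan⇒∥ (b , a₁ , a₂ , b≢0 , eq) = multiple⇒∥ {b = q₁ k * b} {a = a₁ * q₁ k + a₂ * q₂ k} (*-≢0 q₁k≢0 b≢0) λ l → begin
      q₁ k * b * x l                        ≡⟨ ℤP.*-assoc (q₁ k) b (x l) ⟩
      q₁ k * (b * x l)                      ≡⟨ cong (q₁ k *_) (eq l) ⟩
      q₁ k * (a₁ * q₁ l + a₂ * q₂ l)        ≡⟨ expand (q₁ k) a₁ a₂ (q₁ l) (q₂ l) ⟩
      a₁ * q₁ k * q₁ l + a₂ * (q₁ k * q₂ l) ≡⟨ cong (λ t → a₁ * q₁ k * q₁ l + a₂ * t) (q₁∥q₂ k l) ⟩
      a₁ * q₁ k * q₁ l + a₂ * (q₁ l * q₂ k) ≡⟨ collect a₁ a₂ (q₁ k) (q₁ l) (q₂ k) ⟩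
      (a₁ * q₁ k + a₂ * q₂ k) * q₁ l        ∎
      where
        open ≡-Reasoning
        expand : ∀ s a₁ a₂ y z → s * (a₁ * y + a₂ * z) ≡ a₁ * s * y + a₂ * (s * z)
        expand = solve-∀
        collect : ∀ a₁ a₂ s y t → a₁ * s * y + a₂ * (y * t) ≡ (a₁ * s + a₂ * t) * y
        collect = solve-∀

  module _ (x q₁ q₂ : Fin n → ℤ) (i j : Fin n) where

    minor : ℤ
    minor = q₁ i * q₂ j - q₁ j * q₂ i

    cramer₁ : ℤ
    cramer₁ = x i * q₂ j - x j * q₂ i

    cramer₂ : ℤ
    cramer₂ = q₁ i * x j - q₁ j * x i

    module _ {b a₁ a₂ : ℤ} (eq : ∀ k → b * x k ≡ a₁ * q₁ k + a₂ * q₂ k) where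
      open ≡-Reasoning

      b*cramer₁ : b * cramer₁ ≡ a₁ * minor
      b*cramer₁ = begin
        b * (x i * q₂ j - x j * q₂ i)                                    ≡⟨ out b (x i) (x j) (q₂ i) (q₂ j) ⟩
        (b * x i) * q₂ j - (b * x j) * q₂ i                              ≡⟨ cong₂ (λ s t → s * q₂ j - t * q₂ i) (eq i) (eq j) ⟩
        (a₁ * q₁ i + a₂ * q₂ i) * q₂ j - (a₁ * q₁ j + a₂ * q₂ j) * q₂ i  ≡⟨ cancel (q₁ i) (q₁ j) (q₂ i) (q₂ j) a₁ a₂ ⟩
        a₁ * (q₁ i * q₂ j - q₁ j * q₂ i)                                 ∎
        where
          out : ∀ b xi xj yi yj → b * (xi * yj - xj * yi) ≡ (b * xi) * yj - (b * xj) * yi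
          out = solve-∀
          cancel : ∀ pi pj yi yj a₁ a₂ → (a₁ * pi + a₂ * yi) * yj - (a₁ * pj + a₂ * yj) * yi ≡ a₁ * (pi * yj - pj * yi)
          cancel = solve-∀

      b*cramer₂ : b * cramer₂ ≡ a₂ * minor
      b*cramer₂ = begin
        b * (q₁ i * x j - q₁ j * x i)                                    ≡⟨ out b (x i) (x j) (q₁ i) (q₁ j) ⟩
        q₁ i * (b * x j) - q₁ j * (b * x i)                              ≡⟨ cong₂ (λ s t → q₁ i * t - q₁ j * s) (eq i) (eq j) ⟩
        q₁ i * (a₁ * q₁ j + a₂ * q₂ j) - q₁ j * (a₁ * q₁ i + a₂ * q₂ i)  ≡⟨ cancel (q₁ i) (q₁ j) (q₂ i) (q₂ j) a₁ a₂ ⟩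
        a₂ * (q₁ i * q₂ j - q₁ j * q₂ i)                                 ∎
        where
          out : ∀ b xi xj pi pj → b * (pi * xj - pj * xi) ≡ pi * (b * xj) - pj * (b * xi)
          out = solve-∀
          cancel : ∀ pi pj yi yj a₁ a₂ → pi * (a₁ * pj + a₂ * yj) - pj * (a₁ * pi + a₂ * yi) ≡ a₂ * (pi * yj - pj * yi)
          cancel = solve-∀

    -- Cramer's rule on the rows i, j: the coefficients are determined up to the factor b / minor
    InSpan⇒cramer : InSpan x q₁ q₂ → ∀ k → minor * x k ≡ cramer₁ * q₁ k + cramer₂ * q₂ k
    InSpan⇒cramer (b , a₁ , a₂ , b≢0 , eq) k = *-cancelˡ-≢0 b b≢0 (begin
      b * (minor * x k)                            ≡⟨ reorder b minor (x k) ⟩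
      minor * (b * x k)                            ≡⟨ cong (minor *_) (eq k) ⟩
      minor * (a₁ * q₁ k + a₂ * q₂ k)              ≡⟨ spread minor a₁ a₂ (q₁ k) (q₂ k) ⟩
      (a₁ * minor) * q₁ k + (a₂ * minor) * q₂ k    ≡⟨ cong₂ (λ s t → s * q₁ k + t * q₂ k) (b*cramer₁ {b} {a₁} {a₂} eq) (b*cramer₂ {b} {a₁} {a₂} eq) ⟨
      (b * cramer₁) * q₁ k + (b * cramer₂) * q₂ k  ≡⟨ factor b cramer₁ cramer₂ (q₁ k) (q₂ k) ⟩
      b * (cramer₁ * q₁ k + cramer₂ * q₂ k)        ∎)
      where
        open ≡-Reasoning
        reorder : ∀ b d y → b * (d * y) ≡ d * (b * y)
        reorder = solve-∀
        spread : ∀ d a₁ a₂ y z → d * (a₁ * y + a₂ * z) ≡ (a₁ * d) * y + (a₂ * d) * z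
        spread = solve-∀
        factor : ∀ b s t y z → (b * s) * y + (b * t) * z ≡ b * (s * y + t * z)
        factor = solve-∀

  InSpan? : ∀ x q₁ q₂ → Dec (InSpan x q₁ q₂)
  InSpan? x q₁ q₂ with FinP.any? (λ i → FinP.any? (λ j → ¬? (minor x q₁ q₂ i j ℤ.≟ 0ℤ)))
  ... | yes (i , j , minor≢0) =
        Dec.map′ (λ eq → minor x q₁ q₂ i j , cramer₁ x q₁ q₂ i j , cramer₂ x q₁ q₂ i j , minor≢0 , eq)
                 (InSpan⇒cramer x q₁ q₂ i j)
                 (FinP.all? λ k → minor x q₁ q₂ i j * x k ℤ.≟ cramer₁ x q₁ q₂ i j * q₁ k + cramer₂ x q₁ q₂ i j * q₂ k)
  ... | no no-minor = InSpan?-∥ q₁∥q₂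
    where
      q₁∥q₂ : q₁ ∥ q₂
      q₁∥q₂ i j = ℤP.i-j≡0⇒i≡j _ _ (¬≢0⇒≡0 λ minor≢0 → no-minor (i , j , minor≢0))

      vanishes : ∀ (q : Fin n → ℤ) → ¬ (∃[ k ] q k ≢ 0ℤ) → ∀ k → q k ≡ 0ℤ
      vanishes q q-zero k = ¬≢0⇒≡0 λ qk≢0 → q-zero (k , qk≢0)

      InSpan?-∥ : q₁ ∥ q₂ → Dec (InSpan x q₁ q₂)
      InSpan?-∥ q₁∥q₂ with FinP.any? (λ k → ¬? (q₁ k ℤ.≟ 0ℤ)) | FinP.any? (λ k → ¬? (q₂ k ℤ.≟ 0ℤ))
      ... | yes (k , q₁k≢0) | _ = Dec.map′ (∥⇒InSpan {x = x} q₁∥q₂ q₁k≢0) (InSpan⇒∥ q₁∥q₂ q₁k≢0) (∥-dec x q₁)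
      ... | no _ | yes (k , q₂k≢0) =
            Dec.map′ (InSpan-swap ∘ ∥⇒InSpan {x = x} (∥-sym {q₁} {q₂} q₁∥q₂) q₂k≢0)
                     (InSpan⇒∥ (∥-sym {q₁} {q₂} q₁∥q₂) q₂k≢0 ∘ InSpan-swap) (∥-dec x q₂)
      ... | no q₁-zero | no q₂-zero = Dec.map′ zero⇒InSpan InSpan⇒zero (FinP.all? λ k → x k ℤ.≟ 0ℤ)
        where
          zero⇒InSpan : (∀ k → x k ≡ 0ℤ) → InSpan x q₁ q₂
          zero⇒InSpan x≡0 = 1ℤ , 0ℤ , 0ℤ , (λ ()) , λ k → cong (1ℤ *_) (x≡0 k)
          InSpan⇒zero : InSpan x q₁ q₂ → ∀ k → x k ≡ 0ℤ
          InSpan⇒zero (b , a₁ , a₂ , b≢0 , eq) k = *-cancelˡ-≢0 b b≢0 (begin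
            b * x k                  ≡⟨ eq k ⟩
            a₁ * q₁ k + a₂ * q₂ k    ≡⟨ cong₂ (λ s t → a₁ * s + a₂ * t) (vanishes q₁ q₁-zero k) (vanishes q₂ q₂-zero k) ⟩
            a₁ * 0ℤ + a₂ * 0ℤ        ≡⟨ kill a₁ a₂ b ⟩
            b * 0ℤ                   ∎)
            where
              open ≡-Reasoning
              kill : ∀ a₁ a₂ b → a₁ * 0ℤ + a₂ * 0ℤ ≡ b * 0ℤ
              kill = solve-∀

dot : Vec ℤ n → (Fin n → ℤ) → ℤ
dot [] P = 0ℤ
dot (x ∷ xs) P = x * P Fin.zero + dot xs (P ∘ Fin.suc)

ev : (Fin m → ℤ) → Lin m → ℤ
ev P p = dot (coeffs p) P + const p

dot-+ : ∀ (xs ys : Vec ℤ n) P → dot (Vec.zipWith _+_ xs ys) P ≡ dot xs P + dot ys P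
dot-+ [] [] P = refl
dot-+ (x ∷ xs) (y ∷ ys) P =
  trans (cong (λ t → (x + y) * P Fin.zero + t) (dot-+ xs ys (P ∘ Fin.suc)))
        (regroup x y (P Fin.zero) (dot xs (P ∘ Fin.suc)) (dot ys (P ∘ Fin.suc)))
  where regroup : ∀ x y p X Y → (x + y) * p + (X + Y) ≡ (x * p + X) + (y * p + Y)
        regroup = solve-∀

dot-* : ∀ a (xs : Vec ℤ n) P → dot (Vec.map (a *_) xs) P ≡ a * dot xs P
dot-* a [] P = sym (ℤP.*-zeroʳ a)
dot-* a (x ∷ xs) P =
  trans (cong (λ t → a * x * P Fin.zero + t) (dot-* a xs (P ∘ Fin.suc)))
        (regroup a x (P Fin.zero) (dot xs (P ∘ Fin.suc)))
  where regroup : ∀ a x p X → a * x * p + a * X ≡ a * (x * p + X)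
        regroup = solve-∀

ev-+P : ∀ (P : Fin m → ℤ) p q → ev P (p +P q) ≡ ev P p + ev P q
ev-+P P p q = trans (cong (_+ (const p + const q)) (dot-+ (coeffs p) (coeffs q) P))
                    (regroup (dot (coeffs p) P) (dot (coeffs q) P) (const p) (const q))
  where regroup : ∀ X Y c d → (X + Y) + (c + d) ≡ (X + c) + (Y + d)
        regroup = solve-∀

ev-·P : ∀ (P : Fin m → ℤ) a p → ev P (a ·P p) ≡ a * ev P p
ev-·P P a p = trans (cong (_+ a * const p) (dot-* a (coeffs p) P))
                    (sym (ℤP.*-distribˡ-+ a (dot (coeffs p) P) (const p)))

ev-lincomb : ∀ (P : Fin m → ℤ) a b p q → ev P ((a ·P p) +P (b ·P q)) ≡ a * ev P p + b * ev P q
ev-lincomb P a b p q = trans (ev-+P P (a ·P p) (b ·P q)) (cong₂ _+_ (ev-·P P a p) (ev-·P P b q))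

dot-zeros : ∀ P → dot (tabulate {n} λ _ → 0ℤ) P ≡ 0ℤ
dot-zeros {zero} P = refl
dot-zeros {suc n} P = trans (ℤP.+-identityˡ _) (dot-zeros (P ∘ Fin.suc))

dot-indicator : ∀ (v : Fin n) P → dot (tabulate λ j → if does (j Fin.≟ v) then 1ℤ else 0ℤ) P ≡ P v
dot-indicator {suc n} Fin.zero P =
  trans (cong (λ t → 1ℤ * P Fin.zero + t) (dot-zeros (P ∘ Fin.suc)))
        (trans (ℤP.+-identityʳ _) (ℤP.*-identityˡ _))
dot-indicator {suc n} (Fin.suc v) P = trans (ℤP.+-identityˡ _) (dot-indicator v (P ∘ Fin.suc))

ev-varP : ∀ (P : Fin m → ℤ) v c → ev P (varP v c) ≡ P v + c
ev-varP P v c = cong (_+ c) (dot-indicator v P)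

ev-determines-const : ∀ (P : Fin m → ℤ) {p q} → coeffs p ≡ coeffs q → ev P p ≡ ev P q → const p ≡ const q
ev-determines-const P {p} {q} same-coeffs same-ev =
  +-cancelˡ (dot (coeffs q) P) _ _ (trans (cong (λ xs → dot xs P + const p) (sym same-coeffs)) same-ev)

module _ {Ψ : System m} {f : Lin m} where

  M-ind : (S : Lin m → Set) → S f →
          (∀ a b {g h} → S g → S h → S ((a ·P g) +P (b ·P h))) →
          (∀ {g h} b → (g ∣' h) ∈ Ψ → S (b ·P g) → S (b ·P h)) →
          ∀ {g} → M Ψ f g → S g
  M-ind S base-case combo-case divs-case base = base-case
  M-ind S base-case combo-case divs-case (combo a b Mg Mh) =
    combo-case a b (M-ind S base-case combo-case divs-case Mg) (M-ind S base-case combo-case divs-case Mh)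
  M-ind S base-case combo-case divs-case (divs b g∣h Mbg) = divs-case b g∣h (M-ind S base-case combo-case divs-case Mbg)

  M-lincomb : ∀ a b {g h k} → M Ψ f g → M Ψ f h → (∀ i → entry k i ≡ a * entry g i + b * entry h i) → M Ψ f k
  M-lincomb a b {g} {h} Mg Mh eq =
    subst (M Ψ f) (Lin-ext λ i → trans (entry-lincomb a b g h i) (sym (eq i))) (combo a b Mg Mh)

  M-scale : ∀ a {g k} → M Ψ f g → (∀ i → entry k i ≡ a * entry g i) → M Ψ f k
  M-scale a {g} Mg eq = M-lincomb a 0ℤ Mg Mg λ i →
    trans (eq i) (sym (trans (cong (λ t → a * entry g i + t) (ℤP.*-zeroˡ (entry g i))) (ℤP.+-identityʳ _)))

HasConst : System m → Lin m → Set
HasConst Ψ f = ∃[ c ] (c ≢ 0ℤ × M Ψ f (constP c))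

module _ {Ψ : System m} {f f′ : Lin m} (x : ℤ) (Mxf : M Ψ f′ (x ·P f)) where

  M-rescale : ∀ {g} → M Ψ f g → M Ψ f′ (x ·P g)
  M-rescale = M-ind (λ g → M Ψ f′ (x ·P g)) Mxf combo-case divs-case
    where
      combo-case : ∀ a b {g h} → M Ψ f′ (x ·P g) → M Ψ f′ (x ·P h) → M Ψ f′ (x ·P ((a ·P g) +P (b ·P h)))
      combo-case a b {g} {h} Mxg Mxh = M-lincomb a b Mxg Mxh λ i → begin
        entry (x ·P ((a ·P g) +P (b ·P h))) i    ≡⟨ entry-·P x _ i ⟩
        x * entry ((a ·P g) +P (b ·P h)) i      ≡⟨ cong (x *_) (entry-lincomb a b g h i) ⟩
        x * (a * entry g i + b * entry h i)     ≡⟨ distrib x a b (entry g i) (entry h i) ⟩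
        a * (x * entry g i) + b * (x * entry h i) ≡⟨ sym (cong₂ (λ s t → a * s + b * t) (entry-·P x g i) (entry-·P x h i)) ⟩
        a * entry (x ·P g) i + b * entry (x ·P h) i ∎
        where
          open ≡-Reasoning
          distrib : ∀ x a b s t → x * (a * s + b * t) ≡ a * (x * s) + b * (x * t)
          distrib = solve-∀
      divs-case : ∀ {g h} b → (g ∣' h) ∈ Ψ → M Ψ f′ (x ·P (b ·P g)) → M Ψ f′ (x ·P (b ·P h))
      divs-case {g} {h} b g∣h Mxbg =
        subst (M Ψ f′) (sym (·P-assoc x b h)) (divs (x * b) g∣h (subst (M Ψ f′) (·P-assoc x b g) Mxbg))

  HasConst-transfer : x ≢ 0ℤ → HasConst Ψ f → HasConst Ψ f′
  HasConst-transfer x≢0 (c , c≢0 , Mc) = x * c , *-≢0 x≢0 c≢0 , subst (M Ψ f′) (·P-constP x c) (M-rescale Mc)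

HasConst-translates : ∀ {Ψ : System m} {f r₁ r₂ t₁ t₂} → t₁ ≢ 0ℤ → t₂ ≢ 0ℤ →
                      M Ψ f (t₁ ·P r₁) → M Ψ f (t₂ ·P r₂) →
                      coeffs r₁ ≡ coeffs r₂ → const r₁ ≢ const r₂ → HasConst Ψ f
HasConst-translates {r₁ = r₁} {r₂} {t₁} {t₂} t₁≢0 t₂≢0 M₁ M₂ coeffs≡ consts≢ =
  t₁ * t₂ * (c₂ - c₁) , *-≢0 (*-≢0 t₁≢0 t₂≢0) c₂-c₁≢0 , M-lincomb (- t₂) t₁ M₁ M₂ difference
  where
    c₁ c₂ : ℤ
    c₁ = const r₁
    c₂ = const r₂
    c₂-c₁≢0 : c₂ - c₁ ≢ 0ℤ
    c₂-c₁≢0 c₂-c₁≡0 = consts≢ (sym (ℤP.i-j≡0⇒i≡j c₂ c₁ c₂-c₁≡0))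
    subtract : ∀ t₁ t₂ x y → - t₂ * (t₁ * x) + t₁ * (t₂ * y) ≡ t₁ * t₂ * (y - x)
    subtract = solve-∀
    at : ∀ k → - t₂ * (t₁ * entry r₁ k) + t₁ * (t₂ * entry r₂ k) ≡ entry (constP (t₁ * t₂ * (c₂ - c₁))) k
    at Fin.zero = subtract t₁ t₂ c₁ c₂
    at (Fin.suc j) = begin
      - t₂ * (t₁ * coeff r₁ j) + t₁ * (t₂ * coeff r₂ j)  ≡⟨ cong (λ y → - t₂ * (t₁ * coeff r₁ j) + t₁ * (t₂ * y)) (cong (λ v → lookup v j) coeffs≡) ⟨
      - t₂ * (t₁ * coeff r₁ j) + t₁ * (t₂ * coeff r₁ j)  ≡⟨ subtract t₁ t₂ (coeff r₁ j) (coeff r₁ j) ⟩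
      t₁ * t₂ * (coeff r₁ j - coeff r₁ j)                ≡⟨ cong (t₁ * t₂ *_) (ℤP.+-inverseʳ (coeff r₁ j)) ⟩
      t₁ * t₂ * 0ℤ                                       ≡⟨ ℤP.*-zeroʳ (t₁ * t₂) ⟩
      0ℤ                                                 ≡⟨ coeff-constP (t₁ * t₂ * (c₂ - c₁)) j ⟨
      coeff (constP (t₁ * t₂ * (c₂ - c₁))) j             ∎
      where open ≡-Reasoning
    difference : ∀ k → entry (constP (t₁ * t₂ * (c₂ - c₁))) k ≡ - t₂ * entry (t₁ ·P r₁) k + t₁ * entry (t₂ ·P r₂) k
    difference k = sym (trans (cong₂ (λ x y → - t₂ * x + t₁ * y) (entry-·P t₁ r₁ k) (entry-·P t₂ r₂ k)) (at k))

gcdVec : Vec ℤ n → ℕ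
gcdVec xs = ℤ.∣ List.foldr gcd 0ℤ (Vec.toList xs) ∣

gcdVec-∣ : ∀ (xs : Vec ℤ n) i → gcdVec xs ∣ ℤ.∣ lookup xs i ∣
gcdVec-∣ (x ∷ xs) Fin.zero = ℕGCD.gcd[m,n]∣m ℤ.∣ x ∣ (gcdVec xs)
gcdVec-∣ (x ∷ xs) (Fin.suc i) = ∣-trans (ℕGCD.gcd[m,n]∣n ℤ.∣ x ∣ (gcdVec xs)) (gcdVec-∣ xs i)

positive⇒∣∣≢0 : ∀ {x} → 0ℤ ℤ.< x → ℤ.∣ x ∣ ≢ 0
positive⇒∣∣≢0 (ℤ.+<+ (ℕ.s≤s _)) ()

module PrimitivePart (h : Lin m) (const≢0 : ℤ.∣ const h ∣ ≢ 0) (h≥0 : NonNeg h) where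

  -- gcdP h reduces to + g
  g : ℕ
  g = ℕGCD.gcd ℤ.∣ const h ∣ (gcdVec (coeffs h))

  g≢0 : g ≢ 0
  g≢0 = ℕGCD.gcd[m,n]≢0 _ _ (inj₁ const≢0)

  instance
    g-nonZero : ℕ.NonZero g
    g-nonZero = ℕ.≢-nonZero g≢0

  divide : ℤ → ℤ
  divide x = + (ℤ.∣ x ∣ / g)

  pp : Lin m
  pp = lin (Vec.map divide (coeffs h)) (divide (const h))

  g∣entry : ∀ k → g ∣ ℤ.∣ entry h k ∣
  g∣entry Fin.zero = ℕGCD.gcd[m,n]∣m _ _
  g∣entry (Fin.suc j) = ∣-trans (ℕGCD.gcd[m,n]∣n ℤ.∣ const h ∣ (gcdVec (coeffs h))) (gcdVec-∣ (coeffs h) j)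

  g*divide : ∀ x → g ∣ ℤ.∣ x ∣ → g ℕ.* (ℤ.∣ x ∣ / g) ≡ ℤ.∣ x ∣
  g*divide x g∣x = trans (ℕP.*-comm g _) (m/n*n≡m g∣x)

  entry≥0 : ∀ k → 0ℤ ℤ.≤ entry h k
  entry≥0 Fin.zero = proj₂ h≥0
  entry≥0 (Fin.suc j) = proj₁ h≥0 j

  entry-pp : ∀ k → entry pp k ≡ divide (entry h k)
  entry-pp Fin.zero = refl
  entry-pp (Fin.suc j) = VecP.lookup-map j divide (coeffs h)

  entry-h : ∀ k → entry h k ≡ + g * entry pp k
  entry-h k = sym (begin
    + g * entry pp k                      ≡⟨ cong (+ g *_) (entry-pp k) ⟩
    + g * + (ℤ.∣ entry h k ∣ / g)           ≡⟨ ℤP.pos-* g _ ⟨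
    + (g ℕ.* (ℤ.∣ entry h k ∣ / g))         ≡⟨ cong +_ (g*divide (entry h k) (g∣entry k)) ⟩
    + ℤ.∣ entry h k ∣                       ≡⟨ ℤP.0≤i⇒+∣i∣≡i (entry≥0 k) ⟩
    entry h k                             ∎)
    where open ≡-Reasoning

  g*gcdVec : ∀ (xs : Vec ℤ n) → (∀ i → g ∣ ℤ.∣ lookup xs i ∣) → g ℕ.* gcdVec (Vec.map divide xs) ≡ gcdVec xs
  g*gcdVec [] _ = ℕP.*-zeroʳ g
  g*gcdVec (x ∷ xs) g∣xs = trans (ℕGCD.c*gcd[m,n]≡gcd[cm,cn] g _ _)
    (cong₂ ℕGCD.gcd (g*divide x (g∣xs Fin.zero)) (g*gcdVec xs (g∣xs ∘ Fin.suc)))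

  gcdP-pp : gcdP pp ≡ 1ℤ
  gcdP-pp = cong +_ (ℕP.*-cancelˡ-≡ _ 1 g (begin
    g ℕ.* ℤ.∣ gcdP pp ∣  ≡⟨ ℕGCD.c*gcd[m,n]≡gcd[cm,cn] g _ _ ⟩
    ℕGCD.gcd (g ℕ.* ℤ.∣ divide (const h) ∣) (g ℕ.* gcdVec (coeffs pp))
                       ≡⟨ cong₂ ℕGCD.gcd (g*divide (const h) (g∣entry Fin.zero)) (g*gcdVec (coeffs h) (g∣entry ∘ Fin.suc)) ⟩
    g                  ≡⟨ ℕP.*-identityʳ g ⟨
    g ℕ.* 1            ∎))
    where open ≡-Reasoning

  h≡g·pp : h ≡ gcdP h ·P pp
  h≡g·pp = Lin-ext λ k → trans (entry-h k) (sym (entry-·P (gcdP h) pp k))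

  isPrimitivePart : PrimitivePartOf pp h
  isPrimitivePart = h≢0 , (pp≢0 , gcdP-pp) , h≡g·pp
    where
      h≢0 : NonZeroP h
      h≢0 h≡0 = const≢0 (cong (ℤ.∣_∣ ∘ const) h≡0)
      pp≢0 : NonZeroP pp
      pp≢0 pp≡0 = const≢0 (cong ℤ.∣_∣ (trans (entry-h Fin.zero) (trans (cong (λ p → + g * const p) pp≡0) (ℤP.*-zeroʳ (+ g)))))

-- Orders refining the variable classes

module OrderBy {k : ℕ} (key : Fin m → Fin k) (key-injective : Injective _≡_ _≡_ key) where

  below : Fin m → Subset m
  below i = tabulate λ j → does (key j FinP.<? key i)

  ∈-below⁺ : ∀ {i j} → key j Fin.< key i → j ∈ₛ below i
  ∈-below⁺ {i} {j} j<i = VecP.lookup⇒[]= j (below i)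
    (trans (VecP.lookup∘tabulate _ j) (dec-true (key j FinP.<? key i) j<i))

  ∈-below⁻ : ∀ {i j} → j ∈ₛ below i → key j Fin.< key i
  ∈-below⁻ {i} {j} j∈ = invert (subst (Reflects _) does≡true (proof (key j FinP.<? key i)))
    where
      does≡true : does (key j FinP.<? key i) ≡ true
      does≡true = trans (sym (VecP.lookup∘tabulate _ j)) (VecP.[]=⇒lookup j∈)

  below-⊂ : ∀ {i j} → key i Fin.< key j → below i ⊂ below j
  below-⊂ i<j = (λ l∈ → ∈-below⁺ (FinP.<-trans (∈-below⁻ l∈) i<j)) ,
                _ , ∈-below⁺ i<j , FinP.<-irrefl refl ∘ ∈-below⁻

  ∣below∣<m : ∀ i → ∣ below i ∣ ℕ.< m
  ∣below∣<m i = subst (∣ below i ∣ ℕ.<_) (SubsetP.∣⊤∣≡n m)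
    (SubsetP.p⊂q⇒∣p∣<∣q∣ ((λ _ → SubsetP.∈⊤) , i , SubsetP.∈⊤ , FinP.<-irrefl refl ∘ ∈-below⁻))

  rank′ : Fin m → Fin m
  rank′ i = Fin.fromℕ< (∣below∣<m i)

  rank′-mono : ∀ {i j} → key i Fin.< key j → rank′ i Fin.< rank′ j
  rank′-mono {i} {j} i<j = subst₂ ℕ._<_ (sym (FinP.toℕ-fromℕ< (∣below∣<m i))) (sym (FinP.toℕ-fromℕ< (∣below∣<m j)))
    (SubsetP.p⊂q⇒∣p∣<∣q∣ (below-⊂ i<j))

  rank′-injective : Injective _≡_ _≡_ rank′
  rank′-injective {i} {j} rank≡ with FinP.<-cmp (key i) (key j)
  ... | tri< i<j _ _ = ⊥-elim (FinP.<-irrefl rank≡ (rank′-mono i<j))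
  ... | tri≈ _ key≡ _ = key-injective key≡
  ... | tri> _ _ j<i = ⊥-elim (FinP.<-irrefl (sym rank≡) (rank′-mono j<i))

  orderBy : Order m
  orderBy = record { rank = rank′ ; rank-inj = rank′-injective }

classRank<3 : ∀ c → classRank c ℕ.< 3
classRank<3 Zv = ℕ.s≤s ℕ.z≤n
classRank<3 Yv = ℕ.s≤s (ℕ.s≤s ℕ.z≤n)
classRank<3 Wv = ℕP.≤-refl

classRespectingOrder : (cls : Fin m → VarClass) → ∃[ ord ] RespectsClasses cls ord
classRespectingOrder {m} cls = OrderBy.orderBy key key-injective , λ i j lt →
  OrderBy.rank′-mono key key-injective (FinP.combine-monoˡ-< i j (classFin-mono lt))
  where
    classFin : VarClass → Fin 3
    classFin c = Fin.fromℕ< (classRank<3 c)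
    classFin-mono : ∀ {c c′} → classRank c ℕ.< classRank c′ → classFin c Fin.< classFin c′
    classFin-mono {c} {c′} = subst₂ ℕ._<_ (sym (FinP.toℕ-fromℕ< (classRank<3 c))) (sym (FinP.toℕ-fromℕ< (classRank<3 c′)))
    -- variables sorted by class first, then by index
    key : Fin m → Fin (3 ℕ.* m)
    key i = Fin.combine (classFin (cls i)) i
    key-injective : Injective _≡_ _≡_ key
    key-injective {i} {j} = proj₂ ∘ FinP.combine-injective (classFin (cls i)) i (classFin (cls j)) j

_≟Class_ : (c c′ : VarClass) → Dec (c ≡ c′)
Zv ≟Class Zv = yes refl
Yv ≟Class Yv = yes refl
Wv ≟Class Wv = yes refl
Zv ≟Class Yv = no λ ()
Zv ≟Class Wv = no λ ()
Yv ≟Class Zv = no λ ()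
Yv ≟Class Wv = no λ ()
Wv ≟Class Zv = no λ ()
Wv ≟Class Yv = no λ ()

∥⇒multiple : ∀ {f L : Lin m} {j} → entry f ∥ entry L → coeff L j ≡ 1ℤ → f ≡ coeff f j ·P L
∥⇒multiple {f = f} {L} {j} f∥L L-j≡1 = Lin-ext λ k → begin
  entry f k                       ≡⟨ ℤP.*-identityʳ (entry f k) ⟨
  entry f k * 1ℤ                  ≡⟨ cong (entry f k *_) L-j≡1 ⟨
  entry f k * coeff L j           ≡⟨ f∥L k (Fin.suc j) ⟩
  coeff f j * entry L k           ≡⟨ entry-·P (coeff f j) L k ⟨
  entry (coeff f j ·P L) k        ∎
  where open ≡-Reasoning

HasConst-∥ : ∀ {Ψ : System m} {f f′ L} → NonConst f → entry f ∥ entry L → NonZeroP L →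
             M Ψ f′ L → HasConst Ψ f → HasConst Ψ f′
HasConst-∥ {f = f} {f′} {L} (i , f-i≢0) f∥L L≢0 ML =
  HasConst-transfer (coeff L i) (M-scale (coeff f i) ML Lf≡fL) L-i≢0
  where
    Lf≡fL : ∀ k → entry (coeff L i ·P f) k ≡ coeff f i * entry L k
    Lf≡fL k = trans (entry-·P (coeff L i) f k) (trans (ℤP.*-comm (coeff L i) (entry f k)) (sym (f∥L (Fin.suc i) k)))
    L-i≢0 : coeff L i ≢ 0ℤ
    L-i≢0 L-i≡0 = L≢0 (Lin-ext λ k → trans (*-cancelˡ-≢0 (coeff f i) f-i≢0 (begin
      coeff f i * entry L k  ≡⟨ f∥L (Fin.suc i) k ⟩
      entry f k * coeff L i  ≡⟨ cong (entry f k *_) L-i≡0 ⟩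
      entry f k * 0ℤ         ≡⟨ ℤP.*-zeroʳ (entry f k) ⟩
      0ℤ                     ≡⟨ ℤP.*-zeroʳ (coeff f i) ⟨
      coeff f i * 0ℤ         ∎)) (sym (entry-constP-0 k)))
      where open ≡-Reasoning

NonConst? : ∀ (p : Lin m) → Dec (NonConst p)
NonConst? p = FinP.any? λ j → ¬? (coeff p j ℤ.≟ 0ℤ)

constP≡multiple⇒0 : ∀ {f : Lin m} {c} α → NonConst f → constP c ≡ α ·P f → c ≡ 0ℤ
constP≡multiple⇒0 {f = f} {c} α (j , fj≢0) c≡αf = begin
  c             ≡⟨ cong const c≡αf ⟩
  α * const f   ≡⟨ cong (_* const f) α≡0 ⟩
  0ℤ            ∎
  where
    open ≡-Reasoning
    α≡0 : α ≡ 0ℤ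
    α≡0 = *≡0⇒≡0 α fj≢0 (trans (sym (entry-·P α f (Fin.suc j))) (trans (cong (λ p → coeff p j) (sym c≡αf)) (coeff-constP c j)))

BelowClass : (Fin m → VarClass) → VarClass → Lin m → Set
BelowClass cls c g = ∀ j → coeff g j ≢ 0ℤ → classRank (cls j) ℕ.≤ classRank c

BelowLv⇒BelowClass : ∀ {cls : Fin m → VarClass} {ord c f g} → RespectsClasses cls ord →
                     OnlyIn cls c f → BelowLv ord f g → BelowClass cls c g
BelowLv⇒BelowClass {cls = cls} {c = c} respects f-c g-below j gj≢0 with g-below j gj≢0
... | i , fi≢0 , rank-j≤rank-i = ℕP.≮⇒≥ λ c<j →
  ℕP.<⇒≱ (respects i j (subst (λ c′ → classRank c′ ℕ.< classRank (cls j)) (sym (f-c i fi≢0)) c<j)) rank-j≤rank-i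

BelowClass⇒Avoids : ∀ {cls : Fin m → VarClass} {c c′ g} → BelowClass cls c g → classRank c ℕ.< classRank c′ →
                    ∀ j → cls j ≡ c′ → coeff g j ≡ 0ℤ
BelowClass⇒Avoids {cls = cls} g-below c<c′ j j∈c′ = ¬≢0⇒≡0 λ gj≢0 →
  ℕP.<⇒≱ c<c′ (subst (λ c → classRank c ℕ.≤ _) j∈c′ (g-below j gj≢0))

BelowClass-constP : ∀ {cls : Fin m → VarClass} {c} a → BelowClass cls c (constP a)
BelowClass-constP a j aj≢0 = ⊥-elim (aj≢0 (coeff-constP a j))

-- Divisibility modules of a gcd-to-div triple

module _ {d} {Ψ : System m} {u : Vec ℤ d} {E : Vec (Vec ℤ m) d} {cls : Fin m → VarClass}
            (G : GcdToDiv Ψ u E cls) where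

  open GcdToDiv G

  Avoids : VarClass → Lin m → Set
  Avoids c p = ∀ j → cls j ≡ c → coeff p j ≡ 0ℤ

  OnlyIn⇒Avoids : ∀ {c c′ p} → OnlyIn cls c p → c ≢ c′ → Avoids c′ p
  OnlyIn⇒Avoids p-c c≢c′ j j∈c′ = ¬≢0⇒≡0 λ pj≢0 → c≢c′ (trans (sym (p-c j pj≢0)) j∈c′)

  Avoids-·P : ∀ {c p} b → Avoids c p → Avoids c (b ·P p)
  Avoids-·P {p = p} b p-avoids j j∈c =
    trans (entry-·P b p (Fin.suc j)) (trans (cong (b *_) (p-avoids j j∈c)) (ℤP.*-zeroʳ b))

  lhs-avoids-W : ∀ {D} → D ∈ Ψ → Avoids Wv (lhs D)
  lhs-avoids-W {D} D∈ with shape D∈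
  ... | inj₁ (lhs-Z , _) , _ = OnlyIn⇒Avoids {p = lhs D} lhs-Z λ ()
  ... | inj₂ (lhs-Y , _) , _ = OnlyIn⇒Avoids {p = lhs D} lhs-Y λ ()

  lhs-nonzero-const : ∀ {D} → D ∈ Ψ → (∀ j → coeff (lhs D) j ≡ 0ℤ) → const (lhs D) ≢ 0ℤ
  lhs-nonzero-const D∈ coeffs≡0 const≡0 = divSystem D∈ (Lin-ext λ where
    Fin.zero → const≡0
    (Fin.suc j) → trans (coeffs≡0 j) (sym (coeff-constP 0ℤ j)))

  Y-lhs⇒rhs-var : ∀ {D j} → D ∈ Ψ → coeff (lhs D) j ≢ 0ℤ → cls j ≡ Yv →
                  ∃[ w ] (cls w ≡ Wv × rhs D ≡ varP w (const (rhs D)))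
  Y-lhs⇒rhs-var {D} {j} D∈ lhs-j≢0 j∈Y with shape D∈
  ... | inj₁ (lhs-Z , _) , _ with () ← trans (sym j∈Y) (lhs-Z j lhs-j≢0)
  ... | inj₂ (_ , rhs-W , w , rhs-w≢0) , _ =
        w , w∈W , as-varP (proj₁ (proj₂ (proj₂ (wVars w w∈W))) (rhs D) (D , D∈ , inj₂ refl) rhs-w≢0)
    where
      w∈W : cls w ≡ Wv
      w∈W = rhs-W w rhs-w≢0
      as-varP : ∀ {r c} → r ≡ varP w 0ℤ ⊎ r ≡ varP w c → r ≡ varP w (const r)
      as-varP (inj₁ refl) = refl
      as-varP (inj₂ refl) = refl

  zConst : ∀ z → cls z ≡ Zv → ℤ
  zConst z z∈Z = proj₁ (zVars z z∈Z)

  Z-lhs : ∀ {D z} → D ∈ Ψ → (z∈Z : cls z ≡ Zv) → coeff (lhs D) z ≢ 0ℤ → lhs D ≡ varP z (zConst z z∈Z)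
  Z-lhs {D} {z} D∈ z∈Z lhs-z≢0 = proj₁ (proj₂ (proj₂ (zVars z z∈Z))) (lhs D) (D , D∈ , inj₁ refl) lhs-z≢0

  -- Modulo W-polynomials vanishing at the root, M_f is spanned by f, q₁ and q₂,
  -- unless an Obstruction puts a non-zero constant into it.
  module Core (f q₁ q₂ : Lin m) (f-avoids-W : Avoids Wv f)
              (q₁-Y : OnlyIn cls Yv q₁) (q₂-Y : OnlyIn cls Yv q₂)
              {s : ℤ} (s≢0 : s ≢ 0ℤ) (Msq₁ : M Ψ f (s ·P q₁)) (Msq₂ : M Ψ f (s ·P q₂)) where

    Spanned : Lin m → Set
    Spanned p = InSpan (entry p) (entry q₁) (entry q₂)

    Spanned? : ∀ p → Dec (Spanned p)
    Spanned? p = InSpan? (entry p) (entry q₁) (entry q₂)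

    ClashingPair : Div m → Div m → Set
    ClashingPair D₁ D₂ = Spanned (lhs D₁) × Spanned (lhs D₂) ×
                         coeffs (rhs D₁) ≡ coeffs (rhs D₂) × const (rhs D₁) ≢ const (rhs D₂)

    Clash : Set
    Clash = ∃[ D₁ ] Σ (D₁ ∈ Ψ) λ _ → ∃[ D₂ ] Σ (D₂ ∈ Ψ) λ _ → ClashingPair D₁ D₂

    Obstruction : Set
    Obstruction = Spanned (constP 1ℤ) ⊎ Clash

    obstruction? : Dec Obstruction
    obstruction? = Spanned? (constP 1ℤ) ⊎-dec ∃∈? Ψ (λ D₁ _ → ∃∈? Ψ λ D₂ _ → clashing? D₁ D₂)
      where
        clashing? : ∀ D₁ D₂ → Dec (ClashingPair D₁ D₂)
        clashing? D₁ D₂ = Spanned? (lhs D₁) ×-dec Spanned? (lhs D₂) ×-dec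
                          VecP.≡-dec ℤ._≟_ (coeffs (rhs D₁)) (coeffs (rhs D₂)) ×-dec
                          ¬? (const (rhs D₁) ℤ.≟ const (rhs D₂))

    M-spanned : ∀ {p} → Spanned p → ∃[ t ] (t ≢ 0ℤ × M Ψ f (t ·P p))
    M-spanned {p} (b , a₁ , a₂ , b≢0 , bp≡) = s * b , *-≢0 s≢0 b≢0 , M-lincomb a₁ a₂ Msq₁ Msq₂ λ k → begin
      entry ((s * b) ·P p) k                       ≡⟨ entry-·P (s * b) p k ⟩
      s * b * entry p k                            ≡⟨ ℤP.*-assoc s b (entry p k) ⟩
      s * (b * entry p k)                          ≡⟨ cong (s *_) (bp≡ k) ⟩
      s * (a₁ * entry q₁ k + a₂ * entry q₂ k)      ≡⟨ distrib s a₁ a₂ (entry q₁ k) (entry q₂ k) ⟩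
      a₁ * (s * entry q₁ k) + a₂ * (s * entry q₂ k) ≡⟨ sym (cong₂ (λ x y → a₁ * x + a₂ * y) (entry-·P s q₁ k) (entry-·P s q₂ k)) ⟩
      a₁ * entry (s ·P q₁) k + a₂ * entry (s ·P q₂) k ∎
      where
        open ≡-Reasoning
        distrib : ∀ s a₁ a₂ x y → s * (a₁ * x + a₂ * y) ≡ a₁ * (s * x) + a₂ * (s * y)
        distrib = solve-∀

    obstruction⇒HasConst : Obstruction → HasConst Ψ f
    obstruction⇒HasConst (inj₁ one-spanned) with M-spanned one-spanned
    ... | t , t≢0 , Mt = t , t≢0 , subst (M Ψ f) (trans (·P-constP t 1ℤ) (cong constP (ℤP.*-identityʳ t))) Mt
    obstruction⇒HasConst (inj₂ (D₁ , D₁∈ , D₂ , D₂∈ , spanned₁ , spanned₂ , coeffs≡ , consts≢))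
      with M-spanned spanned₁ | M-spanned spanned₂
    ... | t₁ , t₁≢0 , M₁ | t₂ , t₂≢0 , M₂ = HasConst-translates t₁≢0 t₂≢0 (divs t₁ D₁∈ M₁) (divs t₂ D₂∈ M₂) coeffs≡ consts≢

    Feeds : Fin m → Div m → Set
    Feeds w D = Spanned (lhs D) × rhs D ≡ varP w (const (rhs D))

    feeds? : ∀ w D → Dec (Feeds w D)
    feeds? w D = Spanned? (lhs D) ×-dec (rhs D ≟P varP w (const (rhs D)))

    -- without a Clash, every right-hand side w + c of a spanned left-hand side vanishes here
    root : Fin m → ℤ
    root w with ∃∈? Ψ (λ D _ → feeds? w D)
    ... | yes (D , _ , _) = - const (rhs D)
    ... | no _ = 0ℤ

    root-feeds : ¬ Clash → ∀ {w D} → D ∈ Ψ → Feeds w D → root w ≡ - const (rhs D)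
    root-feeds ¬clash {w} {D} D∈ feeds with ∃∈? Ψ (λ D _ → feeds? w D)
    ... | no none = ⊥-elim (none (D , D∈ , feeds))
    ... | yes (D′ , D′∈ , feeds′) with const (rhs D′) ℤ.≟ const (rhs D)
    ...   | yes consts≡ = cong -_ consts≡
    ...   | no consts≢ = ⊥-elim (¬clash (D′ , D′∈ , D , D∈ , proj₁ feeds′ , proj₁ feeds ,
                                          trans (cong coeffs (proj₂ feeds′)) (sym (cong coeffs (proj₂ feeds))) , consts≢))

    -- g ≈ h: g − h is a polynomial in the W-variables vanishing at the root
    _≈_ : Lin m → Lin m → Set
    g ≈ h = (∀ j → cls j ≢ Wv → coeff g j ≡ coeff h j) × ev root g ≡ ev root h

    ≈-lincomb : ∀ a b {g g′ h h′} → g ≈ g′ → h ≈ h′ → ((a ·P g) +P (b ·P h)) ≈ ((a ·P g′) +P (b ·P h′))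
    ≈-lincomb a b {g} {g′} {h} {h′} (coeffs-g , ev-g) (coeffs-h , ev-h) =
      (λ j j∉W → trans (entry-lincomb a b g h (Fin.suc j))
                   (trans (cong₂ (λ x y → a * x + b * y) (coeffs-g j j∉W) (coeffs-h j j∉W))
                          (sym (entry-lincomb a b g′ h′ (Fin.suc j))))) ,
      trans (ev-lincomb root a b g h) (trans (cong₂ (λ x y → a * x + b * y) ev-g ev-h) (sym (ev-lincomb root a b g′ h′)))

    ≈-exact : ∀ {g h} → g ≈ h → Avoids Wv g → Avoids Wv h → g ≡ h
    ≈-exact {g} {h} (coeffs≈ , ev≈) g-avoids h-avoids = Lin-ext λ where
        Fin.zero → ev-determines-const root {g} {h} (Vec-ext same-coeff) ev≈
        (Fin.suc j) → same-coeff j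
      where
        same-coeff : ∀ j → coeff g j ≡ coeff h j
        same-coeff j with cls j ≟Class Wv
        ... | yes j∈W = trans (g-avoids j j∈W) (sym (h-avoids j j∈W))
        ... | no j∉W = coeffs≈ j j∉W

    span : ℤ → ℤ → Lin m
    span a₁ a₂ = (a₁ ·P q₁) +P (a₂ ·P q₂)

    combination : ℤ → ℤ → ℤ → Lin m
    combination a a₁ a₂ = (a ·P f) +P span a₁ a₂

    entry-combination : ∀ a a₁ a₂ k →
      entry (combination a a₁ a₂) k ≡ a * entry f k + (a₁ * entry q₁ k + a₂ * entry q₂ k)
    entry-combination a a₁ a₂ k =
      trans (entry-+P (a ·P f) (span a₁ a₂) k) (cong₂ _+_ (entry-·P a f k) (entry-lincomb a₁ a₂ q₁ q₂ k))

    combination-lincomb : ∀ a b A A₁ A₂ B B₁ B₂ →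
      (a ·P combination A A₁ A₂) +P (b ·P combination B B₁ B₂) ≡
      combination (a * A + b * B) (a * A₁ + b * B₁) (a * A₂ + b * B₂)
    combination-lincomb a b A A₁ A₂ B B₁ B₂ = Lin-ext λ k → begin
      entry ((a ·P combination A A₁ A₂) +P (b ·P combination B B₁ B₂)) k
        ≡⟨ entry-lincomb a b (combination A A₁ A₂) (combination B B₁ B₂) k ⟩
      a * entry (combination A A₁ A₂) k + b * entry (combination B B₁ B₂) k
        ≡⟨ cong₂ (λ x y → a * x + b * y) (entry-combination A A₁ A₂ k) (entry-combination B B₁ B₂ k) ⟩
      a * (A * entry f k + (A₁ * entry q₁ k + A₂ * entry q₂ k)) + b * (B * entry f k + (B₁ * entry q₁ k + B₂ * entry q₂ k))
        ≡⟨ regroup a b A A₁ A₂ B B₁ B₂ (entry f k) (entry q₁ k) (entry q₂ k) ⟩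
      (a * A + b * B) * entry f k + ((a * A₁ + b * B₁) * entry q₁ k + (a * A₂ + b * B₂) * entry q₂ k)
        ≡⟨ sym (entry-combination (a * A + b * B) (a * A₁ + b * B₁) (a * A₂ + b * B₂) k) ⟩
      entry (combination (a * A + b * B) (a * A₁ + b * B₁) (a * A₂ + b * B₂)) k ∎
      where
        open ≡-Reasoning
        regroup : ∀ a b A A₁ A₂ B B₁ B₂ F Q₁ Q₂ →
          a * (A * F + (A₁ * Q₁ + A₂ * Q₂)) + b * (B * F + (B₁ * Q₁ + B₂ * Q₂)) ≡
          (a * A + b * B) * F + ((a * A₁ + b * B₁) * Q₁ + (a * A₂ + b * B₂) * Q₂)
        regroup = solve-∀

    combination-avoids-W : ∀ a a₁ a₂ → Avoids Wv (combination a a₁ a₂)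
    combination-avoids-W a a₁ a₂ j j∈W = begin
      coeff (combination a a₁ a₂) j                                 ≡⟨ entry-combination a a₁ a₂ (Fin.suc j) ⟩
      a * coeff f j + (a₁ * coeff q₁ j + a₂ * coeff q₂ j)          ≡⟨ cong₂ (λ x y → a * x + (a₁ * y + a₂ * coeff q₂ j))
                                                                             (f-avoids-W j j∈W) (q-avoid-W {q₁} q₁-Y) ⟩
      a * 0ℤ + (a₁ * 0ℤ + a₂ * coeff q₂ j)                          ≡⟨ cong (λ y → a * 0ℤ + (a₁ * 0ℤ + a₂ * y)) (q-avoid-W {q₂} q₂-Y) ⟩
      a * 0ℤ + (a₁ * 0ℤ + a₂ * 0ℤ)                                 ≡⟨ zeros a a₁ a₂ ⟩
      0ℤ                                                            ∎
      where
        open ≡-Reasoning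
        q-avoid-W : ∀ {q} → OnlyIn cls Yv q → coeff q j ≡ 0ℤ
        q-avoid-W {q} q-Y = OnlyIn⇒Avoids {p = q} q-Y (λ ()) j j∈W
        zeros : ∀ a a₁ a₂ → a * 0ℤ + (a₁ * 0ℤ + a₂ * 0ℤ) ≡ 0ℤ
        zeros = solve-∀

    Reachable : Lin m → Set
    Reachable g = ∃[ a ] ∃[ a₁ ] ∃[ a₂ ] g ≈ combination a a₁ a₂

    reachable-≡ : ∀ {g} a a₁ a₂ → g ≡ combination a a₁ a₂ → Reachable g
    reachable-≡ a a₁ a₂ refl = a , a₁ , a₂ , (λ _ _ → refl) , refl

    reachable-q₁ : ∀ b → Reachable (b ·P q₁)
    reachable-q₁ b = reachable-≡ 0ℤ b 0ℤ (Lin-ext λ k → trans (entry-·P b q₁ k)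
      (sym (trans (entry-combination 0ℤ b 0ℤ k) (only₁ b (entry f k) (entry q₁ k) (entry q₂ k)))))
      where only₁ : ∀ b x y z → 0ℤ * x + (b * y + 0ℤ * z) ≡ b * y
            only₁ = solve-∀

    reachable-q₂ : ∀ b → Reachable (b ·P q₂)
    reachable-q₂ b = reachable-≡ 0ℤ 0ℤ b (Lin-ext λ k → trans (entry-·P b q₂ k)
      (sym (trans (entry-combination 0ℤ 0ℤ b k) (only₂ b (entry f k) (entry q₁ k) (entry q₂ k)))))
      where only₂ : ∀ b x y z → 0ℤ * x + (0ℤ * y + b * z) ≡ b * z
            only₂ = solve-∀

    DivStep : Set
    DivStep = ∀ {D} → D ∈ Ψ → ∀ b a a₁ a₂ → b ·P lhs D ≡ combination a a₁ a₂ → Reachable (b ·P rhs D)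

    reachable : DivStep → ∀ {g} → M Ψ f g → Reachable g
    reachable step = M-ind Reachable base-case combo-case divs-case
      where
        base-case : Reachable f
        base-case = reachable-≡ 1ℤ 0ℤ 0ℤ (Lin-ext λ k → trans (sym (unit (entry f k) (entry q₁ k) (entry q₂ k)))
                                                         (sym (entry-combination 1ℤ 0ℤ 0ℤ k)))
          where unit : ∀ x y z → 1ℤ * x + (0ℤ * y + 0ℤ * z) ≡ x
                unit = solve-∀
        combo-case : ∀ a b {g h} → Reachable g → Reachable h → Reachable ((a ·P g) +P (b ·P h))
        combo-case a b {g} {h} (A , A₁ , A₂ , g≈) (B , B₁ , B₂ , h≈) =
          a * A + b * B , a * A₁ + b * B₁ , a * A₂ + b * B₂ ,
          subst (((a ·P g) +P (b ·P h)) ≈_) (combination-lincomb a b A A₁ A₂ B B₁ B₂) (≈-lincomb a b {g} {combination A A₁ A₂} {h} {combination B B₁ B₂} g≈ h≈)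
        divs-case : ∀ {g h} b → (g ∣' h) ∈ Ψ → Reachable (b ·P g) → Reachable (b ·P h)
        divs-case {g} b D∈ (a , a₁ , a₂ , bg≈) = step D∈ b a a₁ a₂
          (≈-exact bg≈ (Avoids-·P {p = g} b (lhs-avoids-W D∈)) (combination-avoids-W a a₁ a₂))

    M-avoiding-W : DivStep → ∀ {g} → M Ψ f g → Avoids Wv g → ∃[ a ] ∃[ a₁ ] ∃[ a₂ ] g ≡ combination a a₁ a₂
    M-avoiding-W step Mg g-avoids with reachable step Mg
    ... | a , a₁ , a₂ , g≈ = a , a₁ , a₂ , ≈-exact g≈ g-avoids (combination-avoids-W a a₁ a₂)

    ≈-zero : ∀ g → (∀ j → cls j ≢ Wv → coeff g j ≡ 0ℤ) → ev root g ≡ 0ℤ → g ≈ combination 0ℤ 0ℤ 0ℤ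
    ≈-zero g g-coeffs g-root =
      (λ j j∉W → trans (g-coeffs j j∉W) (sym (trans (entry-combination 0ℤ 0ℤ 0ℤ (Fin.suc j)) (zeros (coeff f j) (coeff q₁ j) (coeff q₂ j))))) ,
      trans g-root (sym (trans (ev-+P root (0ℤ ·P f) (span 0ℤ 0ℤ))
                               (trans (cong₂ _+_ (ev-·P root 0ℤ f) (ev-lincomb root 0ℤ 0ℤ q₁ q₂)) (zeros (ev root f) (ev root q₁) (ev root q₂)))))
      where zeros : ∀ x y z → 0ℤ * x + (0ℤ * y + 0ℤ * z) ≡ 0ℤ
            zeros = solve-∀

    spanned-by : ∀ {b} p a₁ a₂ → b ≢ 0ℤ → b ·P p ≡ combination 0ℤ a₁ a₂ → Spanned p
    spanned-by {b} p a₁ a₂ b≢0 bp≡ = b , a₁ , a₂ , b≢0 , λ k →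
      trans (sym (entry-·P b p k)) (trans (cong (λ r → entry r k) bp≡)
        (trans (entry-combination 0ℤ a₁ a₂ k) (ℤP.+-identityˡ _)))

    constant-spanned : ∀ {p} → (∀ j → coeff p j ≡ 0ℤ) → const p ≢ 0ℤ → Spanned p → Spanned (constP 1ℤ)
    constant-spanned {p} coeffs≡0 const≢0 (b , a₁ , a₂ , b≢0 , eq) =
      b * const p , a₁ , a₂ , *-≢0 b≢0 const≢0 , λ where
        Fin.zero → trans (ℤP.*-identityʳ _) (eq Fin.zero)
        (Fin.suc j) → begin
          b * const p * coeff (constP 1ℤ) j  ≡⟨ cong (b * const p *_) (coeff-constP 1ℤ j) ⟩
          b * const p * 0ℤ                   ≡⟨ ℤP.*-zeroʳ (b * const p) ⟩
          0ℤ                                 ≡⟨ ℤP.*-zeroʳ b ⟨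
          b * 0ℤ                             ≡⟨ cong (b *_) (coeffs≡0 j) ⟨
          b * coeff p j                      ≡⟨ eq (Fin.suc j) ⟩
          a₁ * coeff q₁ j + a₂ * coeff q₂ j  ∎
      where open ≡-Reasoning

    spanned-support-Y : ∀ {p j} → Spanned p → coeff p j ≢ 0ℤ → cls j ≡ Yv
    spanned-support-Y {p} {j} (b , a₁ , a₂ , b≢0 , eq) p-j≢0 with coeff q₁ j ℤ.≟ 0ℤ | coeff q₂ j ℤ.≟ 0ℤ
    ... | no q₁j≢0 | _ = q₁-Y j q₁j≢0
    ... | yes _ | no q₂j≢0 = q₂-Y j q₂j≢0
    ... | yes q₁j≡0 | yes q₂j≡0 = ⊥-elim (*-≢0 b≢0 p-j≢0 (begin
      b * coeff p j                      ≡⟨ eq (Fin.suc j) ⟩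
      a₁ * coeff q₁ j + a₂ * coeff q₂ j  ≡⟨ cong₂ (λ x y → a₁ * x + a₂ * y) q₁j≡0 q₂j≡0 ⟩
      a₁ * 0ℤ + a₂ * 0ℤ                  ≡⟨ zeros a₁ a₂ ⟩
      0ℤ                                 ∎))
      where
        open ≡-Reasoning
        zeros : ∀ a₁ a₂ → a₁ * 0ℤ + a₂ * 0ℤ ≡ 0ℤ
        zeros = solve-∀

    var-rhs≈0 : ¬ Clash → ∀ {D w} → D ∈ Ψ → Spanned (lhs D) → cls w ≡ Wv →
                rhs D ≡ varP w (const (rhs D)) → ∀ b → (b ·P rhs D) ≈ combination 0ℤ 0ℤ 0ℤ
    var-rhs≈0 ¬clash {D} {w} D∈ spanned w∈W rhs≡ b = ≈-zero (b ·P rhs D) rhs-coeffs rhs-root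
      where
        c : ℤ
        c = const (rhs D)
        rhs-coeffs : ∀ j → cls j ≢ Wv → coeff (b ·P rhs D) j ≡ 0ℤ
        rhs-coeffs j j∉W = trans (entry-·P b (rhs D) (Fin.suc j)) (trans (cong (b *_) (¬≢0⇒≡0 λ rhs-j≢0 →
          j∉W (subst (λ v → cls v ≡ Wv) (sym (coeff-varP-≢0 w c j (subst (λ r → coeff r j ≢ 0ℤ) rhs≡ rhs-j≢0))) w∈W)))
          (ℤP.*-zeroʳ b))
        rhs-root : ev root (b ·P rhs D) ≡ 0ℤ
        rhs-root = begin
          ev root (b ·P rhs D)   ≡⟨ ev-·P root b (rhs D) ⟩
          b * ev root (rhs D)    ≡⟨ cong (λ r → b * ev root r) rhs≡ ⟩
          b * ev root (varP w c) ≡⟨ cong (b *_) (ev-varP root w c) ⟩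
          b * (root w + c)       ≡⟨ cong (λ x → b * (x + c)) (root-feeds ¬clash D∈ (spanned , rhs≡)) ⟩
          b * (- c + c)          ≡⟨ cong (b *_) (ℤP.+-inverseˡ c) ⟩
          b * 0ℤ                 ≡⟨ ℤP.*-zeroʳ b ⟩
          0ℤ                     ∎
          where open ≡-Reasoning

    -- a spanned left-hand side is not constant (¬ Obstruction), hence a Y-polynomial,
    -- so its right-hand side is some w + c, which vanishes at the root
    reachable-spanned-rhs : ¬ Obstruction → ∀ {D} → D ∈ Ψ → ∀ b a₁ a₂ →
                            b ·P lhs D ≡ combination 0ℤ a₁ a₂ → Reachable (b ·P rhs D)
    reachable-spanned-rhs ¬obs {D} D∈ b a₁ a₂ b-lhs≡ with b ℤ.≟ 0ℤ
    ... | yes refl = 0ℤ , 0ℤ , 0ℤ , ≈-zero (0ℤ ·P rhs D) (λ j _ → entry-·P 0ℤ (rhs D) (Fin.suc j)) (ev-·P root 0ℤ (rhs D))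
    ... | no b≢0 with NonConst? (lhs D)
    ...   | no lhs-const = ⊥-elim (¬obs (inj₁ (constant-spanned lhs-coeffs≡0 (lhs-nonzero-const D∈ lhs-coeffs≡0)
                                                               (spanned-by (lhs D) a₁ a₂ b≢0 b-lhs≡))))
      where
        lhs-coeffs≡0 : ∀ j → coeff (lhs D) j ≡ 0ℤ
        lhs-coeffs≡0 j = ¬≢0⇒≡0 λ lhs-j≢0 → lhs-const (j , lhs-j≢0)
    ...   | yes (j , lhs-j≢0) with Y-lhs⇒rhs-var D∈ lhs-j≢0 (spanned-support-Y (spanned-by (lhs D) a₁ a₂ b≢0 b-lhs≡) lhs-j≢0)
    ...     | w , w∈W , rhs≡ = 0ℤ , 0ℤ , 0ℤ , var-rhs≈0 (¬obs ∘ inj₂) D∈ (spanned-by (lhs D) a₁ a₂ b≢0 b-lhs≡) w∈W rhs≡ b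

    span-rigid : ¬ Obstruction → ∀ a₁ a₂ → (∀ j → coeff (span a₁ a₂) j ≡ 0ℤ) → ∀ k → entry (span a₁ a₂) k ≡ 0ℤ
    span-rigid ¬obs a₁ a₂ coeffs≡0 (Fin.suc j) = coeffs≡0 j
    span-rigid ¬obs a₁ a₂ coeffs≡0 Fin.zero = ¬≢0⇒≡0 λ K≢0 →
      ¬obs (inj₁ (constant-spanned coeffs≡0 K≢0 (1ℤ , a₁ , a₂ , (λ ()) , λ k →
        trans (ℤP.*-identityˡ _) (entry-lincomb a₁ a₂ q₁ q₂ k))))

  record Rigidity (f : Lin m) (c : VarClass) : Set₁ where
    field
      Obstruction : Set
      obstruction? : Dec Obstruction
      obstruction⇒HasConst : Obstruction → HasConst Ψ f
      rigid : ¬ Obstruction → ∀ {g} → M Ψ f g → BelowClass cls c g → ∃[ α ] g ≡ α ·P f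

  module YCase (f : Lin m) (f-Y : OnlyIn cls Yv f) where

    zero-Y : OnlyIn cls Yv (constP {m} 0ℤ)
    zero-Y j 0≢0 = ⊥-elim (0≢0 (coeff-constP 0ℤ j))

    M-zero : M Ψ f (1ℤ ·P constP 0ℤ)
    M-zero = M-scale 0ℤ base λ k → trans (entry-·P 1ℤ (constP 0ℤ) k) (trans (ℤP.*-identityˡ _) (entry-constP-0 k))

    open Core f f (constP 0ℤ) (OnlyIn⇒Avoids {p = f} f-Y λ ()) f-Y zero-Y {1ℤ} (λ ())
              (subst (M Ψ f) (sym (·P-identity f)) base) M-zero

    merge : ∀ a a₁ a₂ k → entry (combination a a₁ a₂) k ≡ (a + a₁) * entry f k
    merge a a₁ a₂ k = begin
      entry (combination a a₁ a₂) k                                  ≡⟨ entry-combination a a₁ a₂ k ⟩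
      a * entry f k + (a₁ * entry f k + a₂ * entry (constP 0ℤ) k)   ≡⟨ cong (λ x → a * entry f k + (a₁ * entry f k + a₂ * x)) (entry-constP-0 k) ⟩
      a * entry f k + (a₁ * entry f k + a₂ * 0ℤ)                    ≡⟨ collect a a₁ a₂ (entry f k) ⟩
      (a + a₁) * entry f k                                           ∎
      where
        open ≡-Reasoning
        collect : ∀ a a₁ a₂ x → a * x + (a₁ * x + a₂ * 0ℤ) ≡ (a + a₁) * x
        collect = solve-∀

    step : ¬ Obstruction → DivStep
    step ¬obs D∈ b a a₁ a₂ b-lhs≡ = reachable-spanned-rhs ¬obs D∈ b (a + a₁) a₂ (trans b-lhs≡ (Lin-ext λ k →
      trans (merge a a₁ a₂ k) (sym (trans (merge 0ℤ (a + a₁) a₂ k) (cong (_* entry f k) (ℤP.+-identityˡ (a + a₁)))))))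

    rigidity : Rigidity f Yv
    rigidity = record
      { Obstruction = Obstruction
      ; obstruction? = obstruction?
      ; obstruction⇒HasConst = obstruction⇒HasConst
      ; rigid = λ ¬obs {g} Mg g-below → rigid ¬obs Mg (BelowClass⇒Avoids {c = Yv} {Wv} {g} g-below (ℕ.s≤s (ℕ.s≤s ℕ.z≤n)))
      }
      where
        rigid : ¬ Obstruction → ∀ {g} → M Ψ f g → Avoids Wv g → ∃[ α ] g ≡ α ·P f
        rigid ¬obs Mg g-avoids = multiple (M-avoiding-W (step ¬obs) Mg g-avoids)
          where
            multiple : ∀ {g} → ∃[ a ] ∃[ a₁ ] ∃[ a₂ ] g ≡ combination a a₁ a₂ → ∃[ α ] g ≡ α ·P f
            multiple (a , a₁ , a₂ , g≡) = a + a₁ , trans g≡ (Lin-ext λ k → trans (merge a a₁ a₂ k) (sym (entry-·P (a + a₁) f k)))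

  module ZCase {z} (z∈Z : cls z ≡ Zv) (f : Lin m) {s} (s≢0 : s ≢ 0ℤ)
               (f≡sL : f ≡ s ·P varP z (zConst z z∈Z)) where

    L : Lin m
    L = varP z (zConst z z∈Z)

    exactly-two : ExactlyTwo (AsLHS Ψ L)
    exactly-two = proj₂ (proj₂ (proj₂ (zVars z z∈Z)))

    i₁ i₂ : Fin (List.length Ψ)
    i₁ = proj₁ exactly-two
    i₂ = proj₁ (proj₂ exactly-two)

    lhs-i₁ : lhs (List.lookup Ψ i₁) ≡ L
    lhs-i₁ = proj₁ (proj₂ (proj₂ (proj₂ exactly-two)))

    lhs-i₂ : lhs (List.lookup Ψ i₂) ≡ L
    lhs-i₂ = proj₁ (proj₂ (proj₂ (proj₂ (proj₂ exactly-two))))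

    p₁ p₂ : Lin m
    p₁ = rhs (List.lookup Ψ i₁)
    p₂ = rhs (List.lookup Ψ i₂)

    rhs-of-L : ∀ {D} → D ∈ Ψ → lhs D ≡ L → rhs D ≡ p₁ ⊎ rhs D ≡ p₂
    rhs-of-L D∈ lhs≡L with proj₂ (proj₂ (proj₂ (proj₂ (proj₂ exactly-two)))) (Any.index D∈)
                             (trans (cong lhs (sym (AnyP.lookup-index D∈))) lhs≡L)
    ... | inj₁ index≡i₁ = inj₁ (trans (cong rhs (AnyP.lookup-index D∈)) (cong (rhs ∘ List.lookup Ψ) index≡i₁))
    ... | inj₂ index≡i₂ = inj₂ (trans (cong rhs (AnyP.lookup-index D∈)) (cong (rhs ∘ List.lookup Ψ) index≡i₂))

    rhs-Y : ∀ {D} → D ∈ Ψ → lhs D ≡ L → OnlyIn cls Yv (rhs D)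
    rhs-Y {D} D∈ lhs≡L with shape D∈
    ... | inj₁ (_ , rhs-Y′) , _ = rhs-Y′
    ... | inj₂ (lhs-Y , _) , _ = ⊥-elim (Z≢Y (trans (sym z∈Z) (lhs-Y z lhs-z≢0)))
      where
        Z≢Y : Zv ≢ Yv
        Z≢Y ()
        lhs-z≢0 : coeff (lhs D) z ≢ 0ℤ
        lhs-z≢0 lhs-z≡0 with () ← trans (sym (coeff-varP-self z (zConst z z∈Z))) (trans (cong (λ p → coeff p z) (sym lhs≡L)) lhs-z≡0)

    M-sp : ∀ i → lhs (List.lookup Ψ i) ≡ L → M Ψ f (s ·P rhs (List.lookup Ψ i))
    M-sp i lhs≡L = divs s (∈-lookup i) (subst (λ l → M Ψ f (s ·P l)) (sym lhs≡L) (subst (M Ψ f) f≡sL base))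

    coeff-f : ∀ j → coeff f j ≡ s * coeff L j
    coeff-f j = trans (cong (λ p → coeff p j) f≡sL) (entry-·P s L (Fin.suc j))

    f-Z : OnlyIn cls Zv f
    f-Z j fj≢0 = subst (λ v → cls v ≡ Zv) (sym (coeff-varP-≢0 z (zConst z z∈Z) j λ Lj≡0 →
                   fj≢0 (trans (coeff-f j) (trans (cong (s *_) Lj≡0) (ℤP.*-zeroʳ s))))) z∈Z

    open Core f p₁ p₂ (OnlyIn⇒Avoids {p = f} f-Z λ ()) (rhs-Y (∈-lookup i₁) lhs-i₁) (rhs-Y (∈-lookup i₂) lhs-i₂)
              s≢0 (M-sp i₁ lhs-i₁) (M-sp i₂ lhs-i₂)

    step : ¬ Obstruction → DivStep
    step ¬obs {D} D∈ b a a₁ a₂ b-lhs≡ with lhs D ≟P L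
    ... | yes lhs≡L with rhs-of-L D∈ lhs≡L
    ...   | inj₁ rhs≡p₁ = subst (λ r → Reachable (b ·P r)) (sym rhs≡p₁) (reachable-q₁ b)
    ...   | inj₂ rhs≡p₂ = subst (λ r → Reachable (b ·P r)) (sym rhs≡p₂) (reachable-q₂ b)
    step ¬obs {D} D∈ b a a₁ a₂ b-lhs≡ | no lhs≢L =
      reachable-spanned-rhs ¬obs D∈ b a₁ a₂ (trans b-lhs≡ (cong (λ x → combination x a₁ a₂) a≡0))
      where
        -- z occurs only in L, so comparing z-coefficients gives a·s = 0
        p-z : ∀ {i} (lhs≡L : lhs (List.lookup Ψ i) ≡ L) → coeff (rhs (List.lookup Ψ i)) z ≡ 0ℤ
        p-z {i} lhs≡L = OnlyIn⇒Avoids {p = rhs (List.lookup Ψ i)} (rhs-Y (∈-lookup i) lhs≡L) (λ ()) z z∈Z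
        as≡0 : a * s ≡ 0ℤ
        as≡0 = begin
          a * s                                                ≡⟨ kill a a₁ a₂ s ⟨
          a * s + (a₁ * 0ℤ + a₂ * 0ℤ)                           ≡⟨ cong₂ (λ x y → a * x + (a₁ * y + a₂ * 0ℤ))
                                                                        (trans (coeff-f z) (trans (cong (s *_) (coeff-varP-self z (zConst z z∈Z))) (ℤP.*-identityʳ s)))
                                                                        (p-z lhs-i₁) ⟨
          a * coeff f z + (a₁ * coeff p₁ z + a₂ * 0ℤ)           ≡⟨ cong (λ y → a * coeff f z + (a₁ * coeff p₁ z + a₂ * y)) (p-z lhs-i₂) ⟨
          a * coeff f z + (a₁ * coeff p₁ z + a₂ * coeff p₂ z)   ≡⟨ entry-combination a a₁ a₂ (Fin.suc z) ⟨
          coeff (combination a a₁ a₂) z                        ≡⟨ cong (λ r → coeff r z) b-lhs≡ ⟨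
          coeff (b ·P lhs D) z                                 ≡⟨ entry-·P b (lhs D) (Fin.suc z) ⟩
          b * coeff (lhs D) z                                  ≡⟨ cong (b *_) (¬≢0⇒≡0 (lhs≢L ∘ Z-lhs D∈ z∈Z)) ⟩
          b * 0ℤ                                               ≡⟨ ℤP.*-zeroʳ b ⟩
          0ℤ                                                   ∎
          where
            open ≡-Reasoning
            kill : ∀ a a₁ a₂ s → a * s + (a₁ * 0ℤ + a₂ * 0ℤ) ≡ a * s
            kill = solve-∀
        a≡0 : a ≡ 0ℤ
        a≡0 = *≡0⇒≡0 a s≢0 as≡0

    Avoids-non-Z : ∀ {g} → Avoids Yv g → Avoids Wv g → ∀ j → cls j ≢ Zv → coeff g j ≡ 0ℤ
    Avoids-non-Z g-avoids-Y g-avoids-W j j∉Z with cls j in j-class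
    ... | Zv = ⊥-elim (j∉Z refl)
    ... | Yv = g-avoids-Y j j-class
    ... | Wv = g-avoids-W j j-class

    -- the Z-variables occur in f only, the Y-variables in q₁, q₂ only
    span-coeffs≡0 : ∀ {g a a₁ a₂} → Avoids Yv g → Avoids Wv g → g ≡ combination a a₁ a₂ →
                    ∀ j → coeff (span a₁ a₂) j ≡ 0ℤ
    span-coeffs≡0 {g} {a} {a₁} {a₂} g-avoids-Y g-avoids-W g≡ j with cls j ≟Class Zv
    ... | yes j∈Z = begin
      coeff (span a₁ a₂) j                ≡⟨ entry-lincomb a₁ a₂ p₁ p₂ (Fin.suc j) ⟩
      a₁ * coeff p₁ j + a₂ * coeff p₂ j   ≡⟨ cong₂ (λ x y → a₁ * x + a₂ * y) (p-Z lhs-i₁) (p-Z lhs-i₂) ⟩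
      a₁ * 0ℤ + a₂ * 0ℤ                   ≡⟨ zeros a₁ a₂ ⟩
      0ℤ                                  ∎
      where
        open ≡-Reasoning
        p-Z : ∀ {i} → lhs (List.lookup Ψ i) ≡ L → coeff (rhs (List.lookup Ψ i)) j ≡ 0ℤ
        p-Z {i} lhs≡L = OnlyIn⇒Avoids {p = rhs (List.lookup Ψ i)} (rhs-Y (∈-lookup i) lhs≡L) (λ ()) j j∈Z
        zeros : ∀ a₁ a₂ → a₁ * 0ℤ + a₂ * 0ℤ ≡ 0ℤ
        zeros = solve-∀
    ... | no j∉Z = begin
      coeff (span a₁ a₂) j                     ≡⟨ ℤP.+-identityˡ _ ⟨
      0ℤ + coeff (span a₁ a₂) j                ≡⟨ cong (_+ coeff (span a₁ a₂) j) (ℤP.*-zeroʳ a) ⟨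
      a * 0ℤ + coeff (span a₁ a₂) j            ≡⟨ cong (λ x → a * x + coeff (span a₁ a₂) j) (¬≢0⇒≡0 (j∉Z ∘ f-Z j)) ⟨
      a * coeff f j + coeff (span a₁ a₂) j     ≡⟨ cong (_+ coeff (span a₁ a₂) j) (entry-·P a f (Fin.suc j)) ⟨
      coeff (a ·P f) j + coeff (span a₁ a₂) j  ≡⟨ entry-+P (a ·P f) (span a₁ a₂) (Fin.suc j) ⟨
      coeff (combination a a₁ a₂) j            ≡⟨ cong (λ r → coeff r j) g≡ ⟨
      coeff g j                                ≡⟨ Avoids-non-Z {g} g-avoids-Y g-avoids-W j j∉Z ⟩
      0ℤ                                       ∎
      where open ≡-Reasoning

    rigid : ¬ Obstruction → ∀ {g} → M Ψ f g → Avoids Yv g → Avoids Wv g → ∃[ α ] g ≡ α ·P f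
    rigid ¬obs {g} Mg g-avoids-Y g-avoids-W = multiple (M-avoiding-W (step ¬obs) Mg g-avoids-W)
      where
        multiple : ∃[ a ] ∃[ a₁ ] ∃[ a₂ ] g ≡ combination a a₁ a₂ → ∃[ α ] g ≡ α ·P f
        multiple (a , a₁ , a₂ , g≡) = a , trans g≡ (Lin-ext λ k → begin
          entry (combination a a₁ a₂) k            ≡⟨ entry-+P (a ·P f) (span a₁ a₂) k ⟩
          entry (a ·P f) k + entry (span a₁ a₂) k  ≡⟨ cong (λ x → entry (a ·P f) k + x) (span-rigid ¬obs a₁ a₂ span-coeffs k) ⟩
          entry (a ·P f) k + 0ℤ                    ≡⟨ ℤP.+-identityʳ _ ⟩
          entry (a ·P f) k                         ∎)
          where
            open ≡-Reasoning
            span-coeffs : ∀ j → coeff (span a₁ a₂) j ≡ 0ℤ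
            span-coeffs = span-coeffs≡0 {g} {a} {a₁} {a₂} g-avoids-Y g-avoids-W g≡

    rigidity : Rigidity f Zv
    rigidity = record
      { Obstruction = Obstruction
      ; obstruction? = obstruction?
      ; obstruction⇒HasConst = obstruction⇒HasConst
      ; rigid = λ ¬obs {g} Mg g-below →
          rigid ¬obs Mg (BelowClass⇒Avoids {c = Zv} {Yv} {g} g-below (ℕ.s≤s ℕ.z≤n))
                        (BelowClass⇒Avoids {c = Zv} {Wv} {g} g-below (ℕ.s≤s ℕ.z≤n))
      }

  rigidity : ∀ {f D} → NonConst f → D ∈ Ψ → NonConst (lhs D) → entry f ∥ entry (lhs D) →
             ∃[ c ] (OnlyIn cls c f × Rigidity f c)
  rigidity {f} {D} (i , f-i≢0) D∈ (j , lhs-j≢0) f∥lhs with shape D∈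
  ... | inj₁ (lhs-Z , _) , _ = Zv , ZCase.f-Z j∈Z f s≢0 f≡sL , ZCase.rigidity j∈Z f s≢0 f≡sL
    where
      j∈Z : cls j ≡ Zv
      j∈Z = lhs-Z j lhs-j≢0
      s : ℤ
      s = coeff f j
      f≡sL : f ≡ s ·P varP j (zConst j j∈Z)
      f≡sL = ∥⇒multiple (subst (λ L → entry f ∥ entry L) (Z-lhs D∈ j∈Z lhs-j≢0) f∥lhs) (coeff-varP-self j (zConst j j∈Z))
      s≢0 : s ≢ 0ℤ
      s≢0 s≡0 = f-i≢0 (trans (cong (λ p → coeff p i) f≡sL)
                  (trans (entry-·P s (varP j (zConst j j∈Z)) (Fin.suc i)) (trans (cong (_* coeff (varP j (zConst j j∈Z)) i) s≡0) (ℤP.*-zeroˡ (coeff (varP j (zConst j j∈Z)) i)))))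
  ... | inj₂ (lhs-Y , _) , _ = Yv , f-Y , YCase.rigidity f f-Y
    where
      f-Y : OnlyIn cls Yv f
      f-Y k f-k≢0 = lhs-Y k (∥-support {u = entry f} {v = entry (lhs D)} {i = Fin.suc k} {j = Fin.suc j} f∥lhs f-k≢0 lhs-j≢0)

  HasConst? : ∀ {f c} → NonConst f → Rigidity f c → Dec (HasConst Ψ f)
  HasConst? {f} f-nc R with Rigidity.obstruction? R
  ... | yes obs = yes (Rigidity.obstruction⇒HasConst R obs)
  ... | no ¬obs = no λ (c , c≢0 , Mc) →
          let α , c≡αf = Rigidity.rigid R ¬obs Mc (BelowClass-constP c) in c≢0 (constP≡multiple⇒0 α f-nc c≡αf)

  M-unlinked : ∀ {f} → NonConst f → (∀ {D} → D ∈ Ψ → NonConst (lhs D) → ¬ (entry f ∥ entry (lhs D))) →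
               ∀ {g} → M Ψ f g → ∃[ α ] g ≡ α ·P f
  M-unlinked {f} (i , f-i≢0) unlinked = M-ind (λ g → ∃[ α ] g ≡ α ·P f) (1ℤ , sym (·P-identity f)) combo-case divs-case
    where
      combo-case : ∀ a b {g h} → ∃[ α ] g ≡ α ·P f → ∃[ β ] h ≡ β ·P f → ∃[ γ ] (a ·P g) +P (b ·P h) ≡ γ ·P f
      combo-case a b {g} {h} (α , g≡) (β , h≡) = a * α + b * β , Lin-ext λ k → begin
        entry ((a ·P g) +P (b ·P h)) k            ≡⟨ entry-lincomb a b g h k ⟩
        a * entry g k + b * entry h k             ≡⟨ cong₂ (λ x y → a * x + b * y) (trans (cong (λ p → entry p k) g≡) (entry-·P α f k))
                                                                                     (trans (cong (λ p → entry p k) h≡) (entry-·P β f k)) ⟩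
        a * (α * entry f k) + b * (β * entry f k) ≡⟨ collect a b α β (entry f k) ⟩
        (a * α + b * β) * entry f k               ≡⟨ entry-·P (a * α + b * β) f k ⟨
        entry ((a * α + b * β) ·P f) k            ∎
        where
          open ≡-Reasoning
          collect : ∀ a b α β x → a * (α * x) + b * (β * x) ≡ (a * α + b * β) * x
          collect = solve-∀
      -- a non-trivial step b·g = α·f (b, α ≠ 0) would link f to the left-hand side g
      divs-case : ∀ {g h} b → (g ∣' h) ∈ Ψ → ∃[ α ] b ·P g ≡ α ·P f → ∃[ β ] b ·P h ≡ β ·P f
      divs-case {g} {h} b D∈ (α , bg≡αf) with b ℤ.≟ 0ℤ | α ℤ.≟ 0ℤ
      ... | yes refl | _ = 0ℤ , Lin-ext λ k → trans (entry-·P 0ℤ h k) (sym (entry-·P 0ℤ f k))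
      ... | no b≢0 | yes refl = ⊥-elim (divSystem D∈ (Lin-ext λ k → *-cancelˡ-≢0 b b≢0 (begin
            b * entry g k      ≡⟨ entry-·P b g k ⟨
            entry (b ·P g) k   ≡⟨ cong (λ p → entry p k) bg≡αf ⟩
            entry (0ℤ ·P f) k  ≡⟨ entry-·P 0ℤ f k ⟩
            0ℤ                 ≡⟨ ℤP.*-zeroʳ b ⟨
            b * 0ℤ             ≡⟨ cong (b *_) (entry-constP-0 k) ⟨
            b * entry (constP 0ℤ) k ∎)))
        where open ≡-Reasoning
      ... | no b≢0 | no α≢0 = ⊥-elim (unlinked D∈ (i , g-i≢0) (multiple⇒∥ {u = entry f} {v = entry g} {b = α} {a = b} α≢0 αf≡bg))
        where
          αf≡bg : ∀ k → α * entry f k ≡ b * entry g k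
          αf≡bg k = trans (sym (entry-·P α f k)) (trans (cong (λ p → entry p k) (sym bg≡αf)) (entry-·P b g k))
          g-i≢0 : coeff g i ≢ 0ℤ
          g-i≢0 g-i≡0 = *-≢0 α≢0 f-i≢0 (trans (αf≡bg (Fin.suc i)) (trans (cong (b *_) g-i≡0) (ℤP.*-zeroʳ b)))

  NoConstants : Set
  NoConstants = ∀ f → Primitive f → NonConst f → ∀ {D} → D ∈ Ψ → NonConst (lhs D) →
                entry f ∥ entry (lhs D) → ¬ HasConst Ψ f

  increasingForm : NoConstants → ∀ {ord} → RespectsClasses cls ord → IncreasingForm Ψ ord
  increasingForm no-const {ord} respects f f-prim f-nc g Mg g-below
    with ∃∈? Ψ (λ D _ → NonConst? (lhs D) ×-dec ∥-dec (entry f) (entry (lhs D)))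
  ... | yes (D , D∈ , lhs-nc , f∥lhs) =
        let c , f-c , R = rigidity f-nc D∈ lhs-nc f∥lhs in
        Rigidity.rigid R (no-const f f-prim f-nc D∈ lhs-nc f∥lhs ∘ Rigidity.obstruction⇒HasConst R) Mg
                       (BelowLv⇒BelowClass {ord = ord} {c} {f} {g} respects f-c g-below)
  ... | no unlinked = M-unlinked f-nc (λ D∈ lhs-nc f∥lhs → unlinked (_ , D∈ , lhs-nc , f∥lhs)) Mg

  increasing-somewhere⇒everywhere : (∃[ ord ] IncreasingForm Ψ ord) →
                                    ∀ (ord : Order m) → RespectsClasses cls ord → IncreasingForm Ψ ord
  increasing-somewhere⇒everywhere (_ , increasing) ord respects = increasingForm no-const {ord} respects
    where
      no-const : NoConstants
      no-const f f-prim f-nc _ _ _ (c , c≢0 , Mc) =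
        let b , c≡bf = increasing f f-prim f-nc (constP c) Mc (λ j c-j≢0 → ⊥-elim (c-j≢0 (coeff-constP c j))) in
        c≢0 (constP≡multiple⇒0 b f-nc c≡bf)

  module LhsPrimitivePart {D} (D∈ : D ∈ Ψ) =
    PrimitivePart (lhs D) (positive⇒∣∣≢0 (proj₂ (proj₂ (proj₂ (shape D∈))))) (proj₁ (proj₂ (shape D∈)))

  open LhsPrimitivePart using (pp; g; entry-h; isPrimitivePart)

  +g≢0 : ∀ {D} (D∈ : D ∈ Ψ) → + g D∈ ≢ 0ℤ
  +g≢0 D∈ = LhsPrimitivePart.g≢0 D∈ ∘ ℤP.+-injective

  pp-nonconst : ∀ {D} (D∈ : D ∈ Ψ) → NonConst (lhs D) → NonConst (pp D∈)
  pp-nonconst D∈ (j , lhs-j≢0) = j , λ pp-j≡0 →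
    lhs-j≢0 (trans (entry-h D∈ (Fin.suc j)) (trans (cong (+ g D∈ *_) pp-j≡0) (ℤP.*-zeroʳ (+ g D∈))))

  pp∥lhs : ∀ {D} (D∈ : D ∈ Ψ) → entry (pp D∈) ∥ entry (lhs D)
  pp∥lhs D∈ = multiple⇒∥ {b = + g D∈} {a = 1ℤ} (+g≢0 D∈) λ k → trans (sym (entry-h D∈ k)) (sym (ℤP.*-identityˡ _))

  M-lhs : ∀ {D} (D∈ : D ∈ Ψ) → M Ψ (pp D∈) (lhs D)
  M-lhs D∈ = M-scale (+ g D∈) base (entry-h D∈)

  pp-HasConst? : ∀ {D} (D∈ : D ∈ Ψ) → Dec (NonConst (lhs D) × HasConst Ψ (pp D∈))
  pp-HasConst? {D} D∈ with NonConst? (lhs D)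
  ... | no lhs-const = no (lhs-const ∘ proj₁)
  ... | yes lhs-nc = Dec.map′ (lhs-nc ,_) proj₂
          (HasConst? (pp-nonconst D∈ lhs-nc) (proj₂ (proj₂ (rigidity (pp-nonconst D∈ lhs-nc) D∈ lhs-nc (pp∥lhs D∈)))))

  no-increasing⇒constant : ¬ (∃[ ord ] IncreasingForm Ψ ord) →
    ∃[ f ] (NonConst f × (∃[ D ] (D ∈ Ψ × PrimitivePartOf f (lhs D))) × HasConst Ψ f)
  no-increasing⇒constant ¬increasing with ∃∈? Ψ (λ _ D∈ → pp-HasConst? D∈)
  ... | yes (D , D∈ , lhs-nc , pp-const) = pp D∈ , pp-nonconst D∈ lhs-nc , (D , D∈ , isPrimitivePart D∈) , pp-const
  ... | no none = ⊥-elim (¬increasing (ord₀ , increasingForm no-const {ord₀} respects₀))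
    where
      ord₀ : Order m
      ord₀ = proj₁ (classRespectingOrder cls)
      respects₀ : RespectsClasses cls ord₀
      respects₀ = proj₂ (classRespectingOrder cls)
      no-const : NoConstants
      no-const f _ f-nc D∈ lhs-nc f∥lhs f-const =
        none (_ , D∈ , lhs-nc , HasConst-∥ f-nc f∥lhs (divSystem D∈) (M-lhs D∈) f-const)

lemma20 : ∀ {d m : ℕ} (Ψ : System m) (u : Vec ℤ d) (E : Vec (Vec ℤ m) d)
            (cls : Fin m → VarClass) → GcdToDiv Ψ u E cls →
            ((¬ (∃[ ord ] IncreasingForm Ψ ord)) →
               ∃[ f ] (NonConst f
                      × (∃[ D ] (D ∈ Ψ × PrimitivePartOf f (lhs D)))
                      × ∃[ c ] (c ≢ 0ℤ × M Ψ f (constP c))))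
            × ((∃[ ord ] IncreasingForm Ψ ord) →
               ∀ (ord : Order m) → RespectsClasses cls ord → IncreasingForm Ψ ord)
lemma20 Ψ u E cls G = no-increasing⇒constant G , increasing-somewhere⇒everywhere G
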